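{- Let $\mathbf{b}=(b_1,\dots,b_d)\in\mathbb{Z}_{>0}^d$ with $\sum_{i=1}^d b_i$ even, and let $P_{\mathbf{b}}$, $\mathbf{w}$ and the notation $S$, $(S,k)$ be as in the context. Let $\mathbf{u}$ and $\mathbf{v}$ be two vertices of $P_{\mathbf{b}}$. Then $\mathbf{u}$ and $\mathbf{v}$ are adjacent on $P_{\mathbf{b}}$ if and only if (up to swapping $\mathbf{u}$ and $\mathbf{v}$) one of the following holds: (a) $\mathbf{u}=S$ and $\mathbf{v}=T$ for some $S,T\subseteq[d+2]$ with $|S\,\Delta\,T|=1$; (b) $\mathbf{u}=S$ for some $S\subseteq[d+2]$ and either $\mathbf{v}=(S,i)$ for some $i\notin S$ or $\mathbf{v}=(S\setminus\{j\},j)$ for some $j\in S$; (c) $\mathbf{u}=(S,i)$ and $\mathbf{v}=(S,j)$ for some $S\subseteq[d+2]$ and distinct $i,j\notin S$; (d) $\mathbf{u}=(S,i)$ and $\mathbf{v}=(S\cup\{i\},j)$ for some $S\subseteq[d+2]$ and distinct $i,j\notin S$; (e) $\mathbf{u}=(S,i)$ and $\mathbf{v}=(S\cup\{j\},i)$ for some $S\subseteq[d+2]$ and distinct $i,j\notin S$; (f) $\mathbf{u}=(S\cup\{i\},j)$ and $\mathbf{v}=(S\cup\{j\},i)$ for some $S\subseteq[d+2]$ and distinct $i,j\notin S$.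
   Context: Let $\beta=\frac12\sum_{i=1}^d b_i$, $\mathbf{w}=(b_1,\dots,b_d,-\beta,\beta+\frac12)\in\mathbb{R}^{d+2}$, and $P_{\mathbf{b}}=[0,1]^{d+2}\cap\{\mathbf{x}\in\mathbb{R}^{d+2}:\mathbf{w}^\intercal\mathbf{x}\le\beta+\frac14\}$. For $S\subseteq[d+2]$ let $\mathbf{e}_S=\sum_{i\in S}\mathbf{e}_i$. The symbol $S$ (for $S\subseteq[d+2]$) denotes the point $\mathbf{e}_S$, and for $S\subseteq[d+2]$, $k\in[d+2]\setminus S$ the symbol $(S,k)$ denotes the point $\mathbf{e}_S+\frac{\beta+\frac14-\sum_{i\in S}w_i}{w_k}\mathbf{e}_k$, i.e., the intersection point of the segment $[\mathbf{e}_S,\mathbf{e}_{S\cup\{k\}}]$ with the hyperplane $\mathbf{w}^\intercal\mathbf{x}=\beta+\frac14$ when $\mathbf{w}^\intercal\mathbf{e}_S$ and $\mathbf{w}^\intercal\mathbf{e}_{S\cup\{k\}}$ lie strictly on opposite sides of $\beta+\frac14$. Every vertex of $P_{\mathbf{b}}$ is a point of one of these two forms. Adjacent means joined by an edge of $P_{\mathbf{b}}$. -}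

module Defs where

open import Data.Nat using (ℕ; zero; suc)
import Data.Nat as ℕ
open import Data.Integer using (+_)
open import Data.Rational using (ℚ; _/_; _+_; _*_; _-_; -_; _≤_; 0ℚ; 1ℚ; ½)
open import Data.Fin using (Fin; zero; suc; splitAt)
open import Data.Fin.Subset using (Subset; _∈_; _∉_; _∪_; _─_; ⁅_⁆; ∣_∣; inside; outside)
open import Data.Vec using (lookup)
open import Data.Bool using (if_then_else_)
open import Data.Sum using (_⊎_; inj₁; inj₂)
open import Data.Product using (Σ; ∃; _×_; _,_)
open import Relation.Nullary using (¬_)
open import Relation.Binary.PropositionalEquality using (_≡_; _≢_)

sumℕ : ∀ {n} → (Fin n → ℕ) → ℕ
sumℕ {zero} f = 0
sumℕ {suc n} f = f zero ℕ.+ sumℕ (λ i → f (suc i))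

sumℚ : ∀ {n} → (Fin n → ℚ) → ℚ
sumℚ {zero} f = 0ℚ
sumℚ {suc n} f = f zero + sumℚ (λ i → f (suc i))

Pt : ℕ → Set
Pt n = Fin n → ℚ

_·_ : ∀ {n} → Pt n → Pt n → ℚ
x · y = sumℚ (λ i → x i * y i)

_≈_ : ∀ {n} → Pt n → Pt n → Set
x ≈ y = ∀ i → x i ≡ y i

ℕtoℚ : ℕ → ℚ
ℕtoℚ n = (+ n) / 1

β : ∀ d → (Fin d → ℕ) → ℚ
β d b = (+ sumℕ b) / 2

rhs : ∀ d → (Fin d → ℕ) → ℚ
rhs d b = β d b + (+ 1) / 4

w : ∀ d → (Fin d → ℕ) → Pt (d ℕ.+ 2)
w d b i with splitAt d i
... | inj₁ j = ℕtoℚ (b j)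
... | inj₂ zero = - β d b
... | inj₂ (suc zero) = β d b + ½

InP : ∀ d → (Fin d → ℕ) → Pt (d ℕ.+ 2) → Set
InP d b x = (∀ i → (0ℚ ≤ x i) × (x i ≤ 1ℚ)) × (w d b · x ≤ rhs d b)

IsVertex : ∀ d → (Fin d → ℕ) → Pt (d ℕ.+ 2) → Set
IsVertex d b u = InP d b u × Σ (Pt (d ℕ.+ 2)) λ c →
  ∀ x → InP d b x → (c · x ≤ c · u) × (c · x ≡ c · u → x ≈ u)

seg : ∀ {n} → ℚ → Pt n → Pt n → Pt n
seg t u v i = (1ℚ - t) * u i + t * v i

-- u, v adjacent: u ≠ v, both in P_b, and conv{u,v} = P_b ∩ {c·x = max} for some c
-- (i.e. [u,v] is an edge, a face of P_b)
Adjacent : ∀ d → (Fin d → ℕ) → Pt (d ℕ.+ 2) → Pt (d ℕ.+ 2) → Set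
Adjacent d b u v = InP d b u × InP d b v × ¬ (u ≈ v) × Σ (Pt (d ℕ.+ 2)) λ c →
  (c · u ≡ c · v) ×
  (∀ x → InP d b x → (c · x ≤ c · u) ×
     (c · x ≡ c · u → Σ ℚ λ t → (0ℚ ≤ t) × (t ≤ 1ℚ) × (x ≈ seg t u v)))

eS : ∀ {n} → Subset n → Pt n
eS S i = if lookup S i then 1ℚ else 0ℚ

e : ∀ {n} → Fin n → Pt n
e k = eS ⁅ k ⁆

-- the point denoted by the symbol S
IsSetPt : ∀ d → Subset (d ℕ.+ 2) → Pt (d ℕ.+ 2) → Set
IsSetPt d S u = u ≈ eS S

-- the point denoted by the symbol (S,k): e_S + t e_k with t = (β+¼ - Σ_{i∈S} w_i)/w_k,
-- written as t * w_k = β+¼ - Σ_{i∈S} w_i (avoids division; same point whenever w_k ≠ 0)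
IsCutPt : ∀ d → (Fin d → ℕ) → Subset (d ℕ.+ 2) → Fin (d ℕ.+ 2) → Pt (d ℕ.+ 2) → Set
IsCutPt d b S k v = (k ∉ S) × Σ ℚ λ t →
  (t * w d b k ≡ rhs d b - (w d b · eS S)) × (∀ i → v i ≡ eS S i + t * e k i)

-- the disjunction (a)–(f) for the ordered pair (u, v)
Cases : ∀ d → (Fin d → ℕ) → Pt (d ℕ.+ 2) → Pt (d ℕ.+ 2) → Set
Cases d b u v =
  (Σ (Subset (d ℕ.+ 2)) λ S → Σ (Subset (d ℕ.+ 2)) λ T →
     IsSetPt d S u × IsSetPt d T v × (∣ (S ─ T) ∪ (T ─ S) ∣ ≡ 1))
  ⊎ (Σ (Subset (d ℕ.+ 2)) λ S → IsSetPt d S u ×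
     ((Σ (Fin (d ℕ.+ 2)) λ i → (i ∉ S) × IsCutPt d b S i v)
      ⊎ (Σ (Fin (d ℕ.+ 2)) λ j → (j ∈ S) × IsCutPt d b (S ─ ⁅ j ⁆) j v)))
  ⊎ (Σ (Subset (d ℕ.+ 2)) λ S → Σ (Fin (d ℕ.+ 2)) λ i → Σ (Fin (d ℕ.+ 2)) λ j →
     (i ≢ j) × (i ∉ S) × (j ∉ S) × IsCutPt d b S i u × IsCutPt d b S j v)
  ⊎ (Σ (Subset (d ℕ.+ 2)) λ S → Σ (Fin (d ℕ.+ 2)) λ i → Σ (Fin (d ℕ.+ 2)) λ j →
     (i ≢ j) × (i ∉ S) × (j ∉ S) × IsCutPt d b S i u × IsCutPt d b (S ∪ ⁅ i ⁆) j v)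
  ⊎ (Σ (Subset (d ℕ.+ 2)) λ S → Σ (Fin (d ℕ.+ 2)) λ i → Σ (Fin (d ℕ.+ 2)) λ j →
     (i ≢ j) × (i ∉ S) × (j ∉ S) × IsCutPt d b S i u × IsCutPt d b (S ∪ ⁅ j ⁆) i v)
  ⊎ (Σ (Subset (d ℕ.+ 2)) λ S → Σ (Fin (d ℕ.+ 2)) λ i → Σ (Fin (d ℕ.+ 2)) λ j →
     (i ≢ j) × (i ∉ S) × (j ∉ S) × IsCutPt d b (S ∪ ⁅ i ⁆) j u × IsCutPt d b (S ∪ ⁅ j ⁆) i v)

{-# OPTIONS --safe #-}
module Submission where

-- Only one property of P_b is used: the hyperplane w·x = β + ¼ contains no vertex of the cube,
-- since w·e_S is a half-integer and β + ¼ is not.  So everything is proved for the unit cube cut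
-- by any halfspace a·x ≤ ρ with a·e_S ≠ ρ for all S.
--
-- A point of P is a vertex iff it cannot be moved both ways along any direction inside P.
-- Moving along e_k (off the hyperplane) or along a_j e_i − a_i e_j (on it) shows that a vertex
-- has at most one fractional coordinate, and one only if it lies on the hyperplane: every vertex
-- is a point e_S or (S,k).  At the midpoint m of an edge [u,v] every such two-sided direction
-- is parallel to v − u, so m has at most one fractional coordinate when it is off the hyperplane
-- and at most two in any case.  As m is fractional wherever u or v is, and wherever u and v lie
-- on opposite facets, this bounds how the sets and coordinates of u and v can differ, which gives
-- (a)–(f).  Conversely each pair in (a)–(f) spans the intersection of P with a face of the cube
-- ((a), (b)) or with a face of the cube and the hyperplane ((c)–(f)), and such an intersection
-- is exposed by the ±1 functional fixing the face, plus a in the second case.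

open import Defs

module CutCubeEdges where

  open import Level using (0ℓ)
  open import Data.Bool using (true; false; if_then_else_; _∨_; _∧_; not; _xor_)
  open import Data.Bool.Properties
    using (∧-zeroʳ; ∧-identityʳ; ∨-zeroʳ; ∨-identityʳ; ¬-not) renaming (_≟_ to _≟ᵇ_)
  open import Data.Empty using (⊥; ⊥-elim)
  open import Data.Fin using (Fin; zero; suc; splitAt)
  open import Data.Fin.Properties using (any?; ¬∀⟶∃¬) renaming (_≟_ to _≟ᶠ_)
  open import Data.Fin.Subset using (Subset; _∈_; _∉_; _∪_; _─_; ⁅_⁆) renaming (∣_∣ to ∣_∣ˢ)
  open import Data.Fin.Subset.Properties using (∣⁅x⁆∣≡1)
  open import Data.Integer as ℤ using (ℤ; -[1+_])
  import Data.Integer.Properties as ℤₚ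
  import Data.Integer.Tactic.RingSolver as ℤ-Solver
  open import Data.Nat as ℕ using (ℕ; zero; suc)
  import Data.Nat.Properties as ℕₚ
  open import Data.Product using (Σ; _×_; _,_; proj₁; proj₂)
  open import Data.Rational
    using ( ℚ; 0ℚ; 1ℚ; ½; _+_; _*_; _-_; -_; 1/_; ∣_∣; _≤_; _<_; _⊓_
          ; ≢-nonZero; nonNegative; positive; fromℚᵘ )
  open import Data.Rational.Unnormalised as ℚᵘ using (mkℚᵘ; *≡*)
  import Data.Rational.Unnormalised.Properties as ℚᵘₚ
  open import Data.Rational.Properties
    using ( toℚᵘ-injective; toℚᵘ-fromℚᵘ; toℚᵘ-homo-+; fromℚᵘ-cong; fromℚᵘ-injective
          ;  _≟_; ≤-refl; ≤-reflexive; ≤-trans; ≤-antisym; <⇒≤; <-irrefl; <-cmp; ≤-<-trans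
          ; +-identityˡ; +-identityʳ; +-inverseʳ; +-monoˡ-≤; +-monoˡ-<; +-mono-≤; +-mono-<-≤; +-mono-≤-<
          ; *-identityˡ; *-identityʳ; *-zeroˡ; *-zeroʳ; *-assoc; *-comm; *-inverseˡ
          ; *-distribˡ-+; *-distribʳ-+; +-*-commutativeRing; +-comm; neg-injective; 1≢0
          ; nonNegative⁻¹; positive⁻¹; nonNeg*nonNeg⇒nonNeg; pos*pos⇒pos; *-cancelˡ-≤-pos
          ; 0≤∣p∣; ∣p*q∣≡∣p∣*∣q∣; ∣-p∣≡∣p∣; 0≤p⇒∣p∣≡p; ∣p∣≡p∨∣p∣≡-p; ∣p∣≡p⇒0≤p
          ; *-monoʳ-≤-nonNeg; *-cancelʳ-<-nonNeg; ⊓-sel; p⊓q≤p; p⊓q≤q; _<?_ )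
  open import Data.Sum using (_⊎_; inj₁; inj₂; [_,_]′)
  open import Function using (_∘′_)
  open import Data.Vec using (lookup; tabulate; replicate; _∷_; [])
  open import Data.Vec.Properties
    using ( lookup-replicate; lookup-zipWith; lookup∘tabulate; tabulate-cong; tabulate∘lookup
          ; []=⇒lookup; lookup⇒[]= )
  open import Relation.Binary.Definitions using (tri<; tri≈; tri>)
  open import Relation.Binary.PropositionalEquality
  open import Relation.Nullary using (¬_; Dec; yes; no; does)
  open import Relation.Nullary.Decidable using (_×-dec_; toWitness; dec-false)
  open import Relation.Nullary.Decidable.Core using (dec⇒maybe)
  open import Tactic.RingSolver using (solve-∀)
  open import Tactic.RingSolver.Core.AlmostCommutativeRing
    using (AlmostCommutativeRing; fromCommutativeRing)

  ℚ-ring : AlmostCommutativeRing 0ℓ 0ℓ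
  ℚ-ring = fromCommutativeRing +-*-commutativeRing (λ x → dec⇒maybe (0ℚ ≟ x))

  private
    variable
      n : ℕ
      p q r s : ℚ
      i j k l : Fin n
      S T : Subset n
      c u v x y δ : Pt n

  p≤q⇒0≤q-p : p ≤ q → 0ℚ ≤ q - p
  p≤q⇒0≤q-p {p} {q} p≤q = subst (_≤ q - p) (+-inverseʳ p) (+-monoˡ-≤ (- p) p≤q)

  p<q⇒0<q-p : p < q → 0ℚ < q - p
  p<q⇒0<q-p {p} {q} p<q = subst (_< q - p) (+-inverseʳ p) (+-monoˡ-< (- p) p<q)

  private
    q-p+p≡q : ∀ p q → q - p + p ≡ q
    q-p+p≡q = solve-∀ ℚ-ring

  0≤q-p⇒p≤q : 0ℚ ≤ q - p → p ≤ q
  0≤q-p⇒p≤q {q} {p} h = subst₂ _≤_ (+-identityˡ p) (q-p+p≡q p q) (+-monoˡ-≤ p h)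

  0<q-p⇒p<q : 0ℚ < q - p → p < q
  0<q-p⇒p<q {q} {p} h = subst₂ _<_ (+-identityˡ p) (q-p+p≡q p q) (+-monoˡ-< p h)

  -- Inequalities are proved by exhibiting the difference as a manifestly
  -- nonnegative (or positive) expression; the identity is left to the ring solver.
  ≤-by-diff : ∀ {p q} r → q - p ≡ r → 0ℚ ≤ r → p ≤ q
  ≤-by-diff r eq 0≤r = 0≤q-p⇒p≤q (subst (0ℚ ≤_) (sym eq) 0≤r)

  <-by-diff : ∀ {p q} r → q - p ≡ r → 0ℚ < r → p < q
  <-by-diff r eq 0<r = 0<q-p⇒p<q (subst (0ℚ <_) (sym eq) 0<r)

  0≤+0≤⇒0≤ : 0ℚ ≤ p → 0ℚ ≤ q → 0ℚ ≤ p + q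
  0≤+0≤⇒0≤ {p} {q} 0≤p 0≤q = subst (_≤ p + q) (+-identityʳ 0ℚ) (+-mono-≤ 0≤p 0≤q)

  0<+0≤⇒0< : 0ℚ < p → 0ℚ ≤ q → 0ℚ < p + q
  0<+0≤⇒0< {p} {q} 0<p 0≤q = subst (_< p + q) (+-identityʳ 0ℚ) (+-mono-<-≤ 0<p 0≤q)

  0≤*0≤⇒0≤ : 0ℚ ≤ p → 0ℚ ≤ q → 0ℚ ≤ p * q
  0≤*0≤⇒0≤ {p} {q} 0≤p 0≤q = nonNegative⁻¹ _
    {{nonNeg*nonNeg⇒nonNeg p {{nonNegative 0≤p}} q {{nonNegative 0≤q}}}}

  0<*0<⇒0< : 0ℚ < p → 0ℚ < q → 0ℚ < p * q
  0<*0<⇒0< {p} {q} 0<p 0<q = positive⁻¹ _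
    {{pos*pos⇒pos p {{positive 0<p}} q {{positive 0<q}}}}

  0<∧0≤p*q⇒0≤q : 0ℚ < p → 0ℚ ≤ p * q → 0ℚ ≤ q
  0<∧0≤p*q⇒0≤q {p} {q} 0<p 0≤pq = *-cancelˡ-≤-pos p {{positive 0<p}}
    (subst (_≤ p * q) (sym (*-zeroʳ p)) 0≤pq)

  ≤∧≢⇒< : p ≤ q → p ≢ q → p < q
  ≤∧≢⇒< {p} {q} p≤q p≢q with <-cmp p q
  ... | tri< p<q _ _ = p<q
  ... | tri≈ _ p≡q _ = ⊥-elim (p≢q p≡q)
  ... | tri> _ _ p>q = ⊥-elim (p≢q (≤-antisym p≤q (<⇒≤ p>q)))

  <⇒≢0 : 0ℚ < p → p ≢ 0ℚ
  <⇒≢0 0<p p≡0 = <-irrefl (sym p≡0) 0<p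

  0<½ : 0ℚ < ½
  0<½ = positive⁻¹ ½

  ½<1 : ½ < 1ℚ
  ½<1 = toWitness {a? = ½ <? 1ℚ} _

  -[∣p∣]≤p : ∀ p → - ∣ p ∣ ≤ p
  -[∣p∣]≤p p with ∣p∣≡p∨∣p∣≡-p p
  ... | inj₁ ∣p∣≡p = ≤-by-diff (p + p) (trans (cong (λ z → p - - z) ∣p∣≡p) (lemma p))
                       (0≤+0≤⇒0≤ 0≤p 0≤p)
    where 0≤p = ∣p∣≡p⇒0≤p ∣p∣≡p
          lemma : ∀ p → p - - p ≡ p + p
          lemma = solve-∀ ℚ-ring
  ... | inj₂ ∣p∣≡-p = ≤-reflexive (trans (cong -_ ∣p∣≡-p) (lemma p))
    where lemma : ∀ p → - - p ≡ p
          lemma = solve-∀ ℚ-ring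

  p≤∣p∣ : ∀ p → p ≤ ∣ p ∣
  p≤∣p∣ p with ∣p∣≡p∨∣p∣≡-p p
  ... | inj₁ ∣p∣≡p = ≤-reflexive (sym ∣p∣≡p)
  ... | inj₂ ∣p∣≡-p = ≤-by-diff (∣ p ∣ + ∣ p ∣)
                       (trans (cong (_- p) ∣p∣≡-p) (trans (lemma p) (sym (cong₂ _+_ ∣p∣≡-p ∣p∣≡-p))))
                       (0≤+0≤⇒0≤ (0≤∣p∣ p) (0≤∣p∣ p))
    where lemma : ∀ p → - p - p ≡ - p + - p
          lemma = solve-∀ ℚ-ring

  module _ {p} (p≢0 : p ≢ 0ℚ) where
    private
      p⁻¹ : ℚ
      p⁻¹ = (1/ p) {{≢-nonZero p≢0}}

      p⁻¹*p≡1 : p⁻¹ * p ≡ 1ℚ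
      p⁻¹*p≡1 = *-inverseˡ p {{≢-nonZero p≢0}}

    solve-linear : ∀ q → Σ ℚ λ t → t * p ≡ q
    solve-linear q = q * p⁻¹ , (begin
      q * p⁻¹ * p   ≡⟨ *-assoc q p⁻¹ p ⟩
      q * (p⁻¹ * p) ≡⟨ cong (q *_) p⁻¹*p≡1 ⟩
      q * 1ℚ        ≡⟨ *-identityʳ q ⟩
      q             ∎)
      where open ≡-Reasoning

    p*q≡0⇒q≡0 : p * q ≡ 0ℚ → q ≡ 0ℚ
    p*q≡0⇒q≡0 {q} pq≡0 = begin
      q              ≡⟨ sym (*-identityˡ q) ⟩
      1ℚ * q         ≡⟨ cong (_* q) (sym p⁻¹*p≡1) ⟩
      p⁻¹ * p * q    ≡⟨ *-assoc p⁻¹ p q ⟩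
      p⁻¹ * (p * q)  ≡⟨ cong (p⁻¹ *_) pq≡0 ⟩
      p⁻¹ * 0ℚ       ≡⟨ *-zeroʳ p⁻¹ ⟩
      0ℚ             ∎
      where open ≡-Reasoning

  p-q≡0⇒p≡q : p - q ≡ 0ℚ → p ≡ q
  p-q≡0⇒p≡q {p} {q} p-q≡0 = trans (lemma p q) (trans (cong (_+ q) p-q≡0) (+-identityˡ q))
    where lemma : ∀ p q → p ≡ p - q + q
          lemma = solve-∀ ℚ-ring

  p+q≡p⇒q≡0 : p + q ≡ p → q ≡ 0ℚ
  p+q≡p⇒q≡0 {p} {q} eq = trans (lemma p q) (trans (cong (_- p) eq) (+-inverseʳ p))
    where lemma : ∀ p q → q ≡ p + q - p
          lemma = solve-∀ ℚ-ring

  *-cancelʳ-≢0 : r ≢ 0ℚ → p * r ≡ q * r → p ≡ q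
  *-cancelʳ-≢0 {r} {p} {q} r≢0 eq =
    p-q≡0⇒p≡q (p*q≡0⇒q≡0 r≢0 (trans (lemma p q r) (trans (cong (_- q * r) eq) (+-inverseʳ (q * r)))))
    where lemma : ∀ p q r → r * (p - q) ≡ p * r - q * r
          lemma = solve-∀ ℚ-ring

  sum-cong : {f g : Fin n → ℚ} → (∀ i → f i ≡ g i) → sumℚ f ≡ sumℚ g
  sum-cong {zero} f≗g = refl
  sum-cong {suc n} f≗g = cong₂ _+_ (f≗g zero) (sum-cong (λ i → f≗g (suc i)))

  sum-+ : (f g : Fin n → ℚ) → sumℚ (λ i → f i + g i) ≡ sumℚ f + sumℚ g
  sum-+ {zero} f g = refl
  sum-+ {suc n} f g = trans (cong (f zero + g zero +_) (sum-+ (λ i → f (suc i)) (λ i → g (suc i))))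
                            (lemma (f zero) (g zero) _ _)
    where lemma : ∀ a b c d → (a + b) + (c + d) ≡ (a + c) + (b + d)
          lemma = solve-∀ ℚ-ring

  sum-* : ∀ p (f : Fin n → ℚ) → sumℚ (λ i → p * f i) ≡ p * sumℚ f
  sum-* {zero} p f = sym (*-zeroʳ p)
  sum-* {suc n} p f = trans (cong (p * f zero +_) (sum-* p (λ i → f (suc i))))
                            (sym (*-distribˡ-+ p _ _))

  sum-mono-≤ : {f g : Fin n → ℚ} → (∀ i → f i ≤ g i) → sumℚ f ≤ sumℚ g
  sum-mono-≤ {zero} f≤g = ≤-refl
  sum-mono-≤ {suc n} f≤g = +-mono-≤ (f≤g zero) (sum-mono-≤ (λ i → f≤g (suc i)))

  +-mono-≤-equality : p ≤ q → r ≤ s → p + r ≡ q + s → (p ≡ q) × (r ≡ s)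
  +-mono-≤-equality {p} {q} {r} {s} p≤q r≤s eq with <-cmp p q | <-cmp r s
  ... | tri< p<q _ _ | _ = ⊥-elim (<-irrefl eq (+-mono-<-≤ p<q r≤s))
  ... | tri> _ _ p>q | _ = ⊥-elim (<-irrefl refl (≤-<-trans p≤q p>q))
  ... | tri≈ _ _ _ | tri< r<s _ _ = ⊥-elim (<-irrefl eq (+-mono-≤-< p≤q r<s))
  ... | tri≈ _ _ _ | tri> _ _ r>s = ⊥-elim (<-irrefl refl (≤-<-trans r≤s r>s))
  ... | tri≈ _ p≡q _ | tri≈ _ r≡s _ = p≡q , r≡s

  sum-mono-≤-equality : {f g : Fin n → ℚ} → (∀ i → f i ≤ g i) → sumℚ f ≡ sumℚ g → ∀ i → f i ≡ g i
  sum-mono-≤-equality {suc n} f≤g eq zero =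
    proj₁ (+-mono-≤-equality (f≤g zero) (sum-mono-≤ (λ i → f≤g (suc i))) eq)
  sum-mono-≤-equality {suc n} f≤g eq (suc i) = sum-mono-≤-equality (λ i → f≤g (suc i))
    (proj₂ (+-mono-≤-equality (f≤g zero) (sum-mono-≤ (λ i → f≤g (suc i))) eq)) i

  sum-0 : sumℚ {n} (λ _ → 0ℚ) ≡ 0ℚ
  sum-0 {zero} = refl
  sum-0 {suc n} = trans (+-identityˡ _) (sum-0 {n})

  lookup-⁅⁆ : ∀ (k : Fin n) → lookup ⁅ k ⁆ k ≡ true
  lookup-⁅⁆ zero = refl
  lookup-⁅⁆ (suc k) = lookup-⁅⁆ k

  lookup-⁅⁆-≢ : ∀ {k l : Fin n} → l ≢ k → lookup ⁅ k ⁆ l ≡ false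
  lookup-⁅⁆-≢ {k = zero} {zero} l≢k = ⊥-elim (l≢k refl)
  lookup-⁅⁆-≢ {k = zero} {suc l} _ = lookup-replicate l false
  lookup-⁅⁆-≢ {k = suc k} {zero} _ = refl
  lookup-⁅⁆-≢ {k = suc k} {suc l} l≢k = lookup-⁅⁆-≢ (λ l≡k → l≢k (cong suc l≡k))

  lookup-∪ : ∀ (S T : Subset n) l → lookup (S ∪ T) l ≡ lookup S l ∨ lookup T l
  lookup-∪ S T l = lookup-zipWith _∨_ l S T

  lookup-─ : ∀ (S T : Subset n) l → lookup (S ─ T) l ≡ lookup S l ∧ not (lookup T l)
  lookup-─ (x ∷ S) (true ∷ T) zero = sym (∧-zeroʳ x)
  lookup-─ (x ∷ S) (false ∷ T) zero = sym (∧-identityʳ x)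
  lookup-─ (x ∷ S) (y ∷ T) (suc l) = lookup-─ S T l

  lookup-∪⁅⁆ : ∀ (S : Subset n) k → lookup (S ∪ ⁅ k ⁆) k ≡ true
  lookup-∪⁅⁆ S k = trans (lookup-∪ S ⁅ k ⁆ k)
    (trans (cong (lookup S k ∨_) (lookup-⁅⁆ k)) (∨-zeroʳ _))

  lookup-∪⁅⁆-≢ : ∀ (S : Subset n) → l ≢ k → lookup (S ∪ ⁅ k ⁆) l ≡ lookup S l
  lookup-∪⁅⁆-≢ {l = l} {k} S l≢k = trans (lookup-∪ S ⁅ k ⁆ l)
    (trans (cong (lookup S l ∨_) (lookup-⁅⁆-≢ l≢k)) (∨-identityʳ _))

  lookup-─⁅⁆ : ∀ (S : Subset n) k → lookup (S ─ ⁅ k ⁆) k ≡ false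
  lookup-─⁅⁆ S k = trans (lookup-─ S ⁅ k ⁆ k)
    (trans (cong (λ x → lookup S k ∧ not x) (lookup-⁅⁆ k)) (∧-zeroʳ _))

  lookup-─⁅⁆-≢ : ∀ (S : Subset n) → l ≢ k → lookup (S ─ ⁅ k ⁆) l ≡ lookup S l
  lookup-─⁅⁆-≢ {l = l} {k} S l≢k = trans (lookup-─ S ⁅ k ⁆ l)
    (trans (cong (λ x → lookup S l ∧ not x) (lookup-⁅⁆-≢ l≢k)) (∧-identityʳ _))

  lookup-symdiff : ∀ (S T : Subset n) l → lookup ((S ─ T) ∪ (T ─ S)) l ≡ lookup S l xor lookup T l
  lookup-symdiff S T l rewrite lookup-∪ (S ─ T) (T ─ S) l | lookup-─ S T l | lookup-─ T S l
    with lookup S l | lookup T l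
  ... | true | true = refl
  ... | true | false = refl
  ... | false | true = refl
  ... | false | false = refl

  ∉⇒lookup≡false : i ∉ S → lookup S i ≡ false
  ∉⇒lookup≡false {i = i} {S} i∉S with lookup S i in eq
  ... | true = ⊥-elim (i∉S (lookup⇒[]= i S eq))
  ... | false = refl

  lookup≡false⇒∉ : lookup S i ≡ false → i ∉ S
  lookup≡false⇒∉ eq i∈S with trans (sym ([]=⇒lookup i∈S)) eq
  ... | ()

  subset-ext : (∀ l → lookup S l ≡ lookup T l) → S ≡ T
  subset-ext {S = S} {T} eq =
    trans (sym (tabulate∘lookup S)) (trans (tabulate-cong eq) (tabulate∘lookup T))

  AgreeOff : Fin n → Fin n → Subset n → Subset n → Set
  AgreeOff i j S T = ∀ l → l ≢ i → l ≢ j → lookup S l ≡ lookup T l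

  agreeOff-ext : ∀ {S T : Subset n} {i j} → lookup S i ≡ lookup T i → lookup S j ≡ lookup T j →
                 AgreeOff i j S T → S ≡ T
  agreeOff-ext {i = i} {j} at-i at-j off = subset-ext at
    where
    at : ∀ l → _
    at l with l ≟ᶠ i | l ≟ᶠ j
    ... | yes refl | _ = at-i
    ... | no _ | yes refl = at-j
    ... | no l≢i | no l≢j = off l l≢i l≢j

  agreeOff-sym : AgreeOff i j S T → AgreeOff i j T S
  agreeOff-sym agree l l≢i l≢j = sym (agree l l≢i l≢j)

  agreeOff-swap : AgreeOff i j S T → AgreeOff j i S T
  agreeOff-swap agree l l≢j l≢i = agree l l≢i l≢j

  agreeOff⇒≡∪⁅⁆ : AgreeOff i j S T → lookup S i ≡ lookup T i → lookup S j ≡ false → lookup T j ≡ true →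
                  T ≡ S ∪ ⁅ j ⁆
  agreeOff⇒≡∪⁅⁆ {i = i} {j} {S} {T} agree at-i Sj≡false Tj≡true = agreeOff-ext {i = i} {j}
    (trans (sym at-i) (sym (lookup-∪⁅⁆-≢ S i≢j)))
    (trans Tj≡true (sym (lookup-∪⁅⁆ S j)))
    (λ l l≢i l≢j → trans (sym (agree l l≢i l≢j)) (sym (lookup-∪⁅⁆-≢ S l≢j)))
    where
    i≢j : i ≢ j
    i≢j refl with trans (sym Sj≡false) (trans at-i Tj≡true)
    ... | ()

  DifferOnlyAt : Fin n → Subset n → Subset n → Set
  DifferOnlyAt k S T = (lookup S k ≢ lookup T k) × AgreeOff k k S T

  differOnlyAt⇒symdiff≡⁅⁆ : DifferOnlyAt k S T → (S ─ T) ∪ (T ─ S) ≡ ⁅ k ⁆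
  differOnlyAt⇒symdiff≡⁅⁆ {k = k} {S} {T} (differ , agree) = agreeOff-ext
    (trans (lookup-symdiff S T k) (trans (xor-≢ differ) (sym (lookup-⁅⁆ k))))
    (trans (lookup-symdiff S T k) (trans (xor-≢ differ) (sym (lookup-⁅⁆ k))))
    (λ l l≢k _ → trans (lookup-symdiff S T l) (trans (xor-≡ (agree l l≢k l≢k)) (sym (lookup-⁅⁆-≢ l≢k))))
    where
    xor-≢ : ∀ {x y} → x ≢ y → x xor y ≡ true
    xor-≢ {true} {true} x≢y = ⊥-elim (x≢y refl)
    xor-≢ {true} {false} _ = refl
    xor-≢ {false} {true} _ = refl
    xor-≢ {false} {false} x≢y = ⊥-elim (x≢y refl)
    xor-≡ : ∀ {x y} → x ≡ y → x xor y ≡ false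
    xor-≡ {true} refl = refl
    xor-≡ {false} refl = refl

  ∣p∣≡1⇒p≡⁅k⁆ : ∀ (P : Subset n) → ∣ P ∣ˢ ≡ 1 → Σ (Fin n) λ k → P ≡ ⁅ k ⁆
  ∣p∣≡1⇒p≡⁅k⁆ (true ∷ P) ∣P∣≡1 = zero , cong (true ∷_) (empty P (ℕₚ.suc-injective ∣P∣≡1))
    where
    empty : ∀ {n} (P : Subset n) → ∣ P ∣ˢ ≡ 0 → P ≡ replicate n false
    empty [] _ = refl
    empty (false ∷ P) ∣P∣≡0 = cong (false ∷_) (empty P ∣P∣≡0)
  ∣p∣≡1⇒p≡⁅k⁆ (false ∷ P) ∣P∣≡1 with ∣p∣≡1⇒p≡⁅k⁆ P ∣P∣≡1
  ... | k , P≡⁅k⁆ = suc k , cong (false ∷_) P≡⁅k⁆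

  symdiff≡⁅⁆⇒differOnlyAt : (S ─ T) ∪ (T ─ S) ≡ ⁅ k ⁆ → DifferOnlyAt k S T
  symdiff≡⁅⁆⇒differOnlyAt {S = S} {T} {k} eq = differ , agree
    where
    xor-at : ∀ l → lookup S l xor lookup T l ≡ lookup ⁅ k ⁆ l
    xor-at l = trans (sym (lookup-symdiff S T l)) (cong (λ P → lookup P l) eq)
    differ : lookup S k ≢ lookup T k
    differ S≡T = xor-self {lookup S k} (subst (λ y → lookup S k xor y ≡ true) (sym S≡T)
                                  (trans (xor-at k) (lookup-⁅⁆ k)))
      where xor-self : ∀ {x} → x xor x ≢ true
            xor-self {true} ()
            xor-self {false} ()
    agree : AgreeOff k k S T
    agree l l≢k _ = xor-false (trans (xor-at l) (lookup-⁅⁆-≢ l≢k))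
      where xor-false : ∀ {x y} → x xor y ≡ false → x ≡ y
            xor-false {true} {true} _ = refl
            xor-false {false} {false} _ = refl

  eS-true : lookup S l ≡ true → eS S l ≡ 1ℚ
  eS-true eq rewrite eq = refl

  eS-false : lookup S l ≡ false → eS S l ≡ 0ℚ
  eS-false eq rewrite eq = refl

  eS-cong : lookup S l ≡ lookup T l → eS S l ≡ eS T l
  eS-cong eq = cong (if_then 1ℚ else 0ℚ) eq

  e-same : ∀ (k : Fin n) → e k k ≡ 1ℚ
  e-same k = eS-true {S = ⁅ k ⁆} (lookup-⁅⁆ k)

  e-≢ : l ≢ k → e k l ≡ 0ℚ
  e-≢ {l = l} {k} l≢k = eS-false {S = ⁅ k ⁆} {l} (lookup-⁅⁆-≢ l≢k)

  ∉⇒eS≡0 : i ∉ S → eS S i ≡ 0ℚ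
  ∉⇒eS≡0 {i = i} {S} i∉S = eS-false {S = S} {i} (∉⇒lookup≡false i∉S)

  ∈⇒eS≡1 : i ∈ S → eS S i ≡ 1ℚ
  ∈⇒eS≡1 {i = i} {S} i∈S = eS-true {S = S} {i} ([]=⇒lookup i∈S)

  eS-∪⁅⁆-same : ∀ (S : Subset n) k → eS (S ∪ ⁅ k ⁆) k ≡ 1ℚ
  eS-∪⁅⁆-same S k = eS-true {S = S ∪ ⁅ k ⁆} {k} (lookup-∪⁅⁆ S k)

  eS-∪⁅⁆-≢ : ∀ (S : Subset n) → l ≢ k → eS (S ∪ ⁅ k ⁆) l ≡ eS S l
  eS-∪⁅⁆-≢ {l = l} {k} S l≢k = eS-cong {S = S ∪ ⁅ k ⁆} {l} {S} (lookup-∪⁅⁆-≢ S l≢k)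

  eS-─⁅⁆-≢ : ∀ (S : Subset n) → l ≢ k → eS (S ─ ⁅ k ⁆) l ≡ eS S l
  eS-─⁅⁆-≢ {l = l} {k} S l≢k = eS-cong {S = S ─ ⁅ k ⁆} {l} {S} (lookup-─⁅⁆-≢ S l≢k)

  eS-∪⁅⁆≡+e : k ∉ S → ∀ l → eS (S ∪ ⁅ k ⁆) l ≡ eS S l + e k l
  eS-∪⁅⁆≡+e {k = k} {S} k∉S l with l ≟ᶠ k
  ... | yes refl = trans (eS-∪⁅⁆-same S k) (sym (trans (cong₂ _+_ (∉⇒eS≡0 k∉S) (e-same k)) (+-identityˡ 1ℚ)))
  ... | no l≢k = trans (eS-∪⁅⁆-≢ S l≢k) (sym (trans (cong (eS S l +_) (e-≢ l≢k)) (+-identityʳ (eS S l))))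

  ·-cong : ∀ (c : Pt n) → x ≈ y → c · x ≡ c · y
  ·-cong c x≈y = sum-cong (λ i → cong (c i *_) (x≈y i))

  ·-+ : ∀ (c x y : Pt n) → c · (λ l → x l + y l) ≡ c · x + c · y
  ·-+ c x y = trans (sum-cong (λ i → *-distribˡ-+ (c i) (x i) (y i)))
                    (sum-+ (λ i → c i * x i) (λ i → c i * y i))

  +-· : ∀ (c c′ x : Pt n) → (λ l → c l + c′ l) · x ≡ c · x + c′ · x
  +-· c c′ x = trans (sum-cong (λ i → *-distribʳ-+ (x i) (c i) (c′ i)))
                     (sum-+ (λ i → c i * x i) (λ i → c′ i * x i))

  ·-* : ∀ (c : Pt n) p x → c · (λ l → p * x l) ≡ p * (c · x)
  ·-* c p x = trans (sum-cong (λ i → lemma (c i) p (x i))) (sum-* p (λ i → c i * x i))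
    where lemma : ∀ c p x → c * (p * x) ≡ p * (c * x)
          lemma = solve-∀ ℚ-ring

  ·-e : ∀ (c : Pt n) k → c · e k ≡ c k
  ·-e {suc n} c zero = trans (cong₂ _+_ (*-identityʳ (c zero))
    (trans (sum-cong (λ i → trans (cong (c (suc i) *_) (eS-false {S = replicate n false} {i} (lookup-replicate i false)))
                                  (*-zeroʳ (c (suc i)))))
           (sum-0 {n})))
    (+-identityʳ (c zero))
  ·-e {suc n} c (suc k) = trans (cong₂ _+_ (*-zeroʳ (c zero)) (·-e (λ i → c (suc i)) k)) (+-identityˡ _)

  ·-single : ∀ (c : Pt n) → (∀ l → l ≢ k → y l ≡ 0ℚ) → c · y ≡ c k * y k
  ·-single {k = k} {y} c off = begin
    c · y                       ≡⟨ ·-cong c y≈ ⟩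
    c · (λ l → y k * e k l)     ≡⟨ ·-* c (y k) (e k) ⟩
    y k * (c · e k)             ≡⟨ cong (y k *_) (·-e c k) ⟩
    y k * c k                   ≡⟨ *-comm (y k) (c k) ⟩
    c k * y k                   ∎
    where
    open ≡-Reasoning
    y≈ : y ≈ (λ l → y k * e k l)
    y≈ l with l ≟ᶠ k
    ... | yes refl = sym (trans (cong (y l *_) (e-same l)) (*-identityʳ (y l)))
    ... | no l≢k = trans (off l l≢k) (sym (trans (cong (y k *_) (e-≢ l≢k)) (*-zeroʳ (y k))))

  move : Pt n → ℚ → Pt n → Pt n
  move x s δ l = x l + s * δ l

  ·-move : ∀ (c : Pt n) x s δ → c · move x s δ ≡ c · x + s * (c · δ)
  ·-move c x s δ = trans (·-+ c x (λ l → s * δ l)) (cong (c · x +_) (·-* c s δ))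

  ·-seg : ∀ (c : Pt n) t u v → c · seg t u v ≡ (1ℚ - t) * (c · u) + t * (c · v)
  ·-seg c t u v = trans (·-+ c (λ l → (1ℚ - t) * u l) (λ l → t * v l))
                        (cong₂ _+_ (·-* c (1ℚ - t) u) (·-* c t v))

  ·-diff : ∀ (c x y : Pt n) → c · (λ l → x l - y l) ≡ c · x - c · y
  ·-diff c x y = trans (sum-cong (λ l → lemma (c l) (x l) (y l)))
    (trans (sum-+ (λ l → c l * x l) (λ l → - 1ℚ * (c l * y l)))
           (trans (cong (c · x +_) (sum-* (- 1ℚ) (λ l → c l * y l))) (lemma′ (c · x) (c · y))))
    where lemma : ∀ c x y → c * (x - y) ≡ c * x + - 1ℚ * (c * y)
          lemma = solve-∀ ℚ-ring
          lemma′ : ∀ p q → p + - 1ℚ * q ≡ p - q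
          lemma′ = solve-∀ ℚ-ring

  mid : Pt n → Pt n → Pt n
  mid = seg ½

  mid-comm : ∀ (u v : Pt n) l → mid u v l ≡ mid v u l
  mid-comm u v l = +-comm ((1ℚ - ½) * u l) (½ * v l)

  Exposes : (Pt n → Set) → Pt n → Pt n → Set
  Exposes K c u = ∀ x → K x → (c · x ≤ c · u) × (c · x ≡ c · u → x ≈ u)

  OnSegment : Pt n → Pt n → Pt n → Set
  OnSegment u v x = Σ ℚ λ t → (0ℚ ≤ t) × (t ≤ 1ℚ) × (x ≈ seg t u v)

  IsEdge : (Pt n → Set) → Pt n → Pt n → Set
  IsEdge K u v = K u × K v × ¬ (u ≈ v) × Σ (Pt _) λ c → (c · u ≡ c · v) ×
    (∀ x → K x → (c · x ≤ c · u) × (c · x ≡ c · u → OnSegment u v x))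

  FreeDirection : (Pt n → Set) → Pt n → Pt n → Set
  FreeDirection K x δ = Σ ℚ λ ε → (0ℚ < ε) × K (move x ε δ) × K (move x (- ε) δ)

  flat : ∀ (c x : Pt n) δ ε → c · move x ε δ ≤ c · x → c · move x (- ε) δ ≤ c · x →
         c · move x ε δ ≡ c · x
  flat c x δ ε ≤₊ ≤₋ =
    trans (·-move c x ε δ) (trans (cong (c · x +_) ε*c·δ≡0) (+-identityʳ (c · x)))
    where
    lemma₊ : ∀ a y → 0ℚ - y ≡ a - (a + y)
    lemma₊ = solve-∀ ℚ-ring
    lemma₋ : ∀ a ε y → ε * y - 0ℚ ≡ a - (a + - ε * y)
    lemma₋ = solve-∀ ℚ-ring
    ε*c·δ≡0 : ε * (c · δ) ≡ 0ℚ
    ε*c·δ≡0 = ≤-antisym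
      (≤-by-diff _ (trans (lemma₊ (c · x) (ε * (c · δ))) (cong (λ z → c · x - z) (sym (·-move c x ε δ))))
                 (p≤q⇒0≤q-p ≤₊))
      (≤-by-diff _ (trans (lemma₋ (c · x) ε (c · δ)) (cong (λ z → c · x - z) (sym (·-move c x (- ε) δ))))
                 (p≤q⇒0≤q-p ≤₋))

  exposed-no-free-direction : ∀ {K : Pt n → Set} → Exposes K c u → FreeDirection K u δ → ∀ l → δ l ≡ 0ℚ
  exposed-no-free-direction {c = c} {u} {δ} exposes (ε , 0<ε , K₊ , K₋) l =
    p*q≡0⇒q≡0 (<⇒≢0 0<ε) (p+q≡p⇒q≡0 (moved≈u l))
    where
    moved≈u : move u ε δ ≈ u
    moved≈u = proj₂ (exposes _ K₊) (flat c u δ ε (proj₁ (exposes _ K₊)) (proj₁ (exposes _ K₋)))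

  edge-sym : ∀ {K : Pt n → Set} → IsEdge K u v → IsEdge K v u
  edge-sym {u = u} {v} (Ku , Kv , u≉v , c , cu≡cv , face) =
    Kv , Ku , (λ v≈u → u≉v (λ l → sym (v≈u l))) , c , sym cu≡cv ,
    λ x Kx → subst (c · x ≤_) cu≡cv (proj₁ (face x Kx)) ,
             λ cx≡cv → reverse (proj₂ (face x Kx) (trans cx≡cv (sym cu≡cv)))
    where
    reverse : ∀ {x} → OnSegment u v x → OnSegment v u x
    reverse (t , 0≤t , t≤1 , x≈seg) = 1ℚ - t , p≤q⇒0≤q-p t≤1 , ≤-by-diff t (lemma₁ t) 0≤t ,
                                      λ l → trans (x≈seg l) (lemma₂ t (u l) (v l))
      where lemma₁ : ∀ t → 1ℚ - (1ℚ - t) ≡ t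
            lemma₁ = solve-∀ ℚ-ring
            lemma₂ : ∀ t a b → (1ℚ - t) * a + t * b ≡ (1ℚ - (1ℚ - t)) * b + (1ℚ - t) * a
            lemma₂ = solve-∀ ℚ-ring

  edge-mid-direction-parallel : ∀ {K : Pt n → Set} {ε} → IsEdge K u v →
    K (move (mid u v) ε δ) → K (move (mid u v) (- ε) δ) → Σ ℚ λ τ → ∀ l → ε * δ l ≡ τ * (v l - u l)
  edge-mid-direction-parallel {u = u} {v} {δ} {ε = ε} (_ , _ , _ , c , cu≡cv , face) K₊ K₋ =
    proj₁ on-segment - ½ , displacement
    where
    c·mid≡c·u : c · mid u v ≡ c · u
    c·mid≡c·u = trans (·-seg c ½ u v) (trans (cong (λ z → (1ℚ - ½) * (c · u) + ½ * z) (sym cu≡cv))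
                                            (lemma (c · u) ½))
      where lemma : ∀ a h → (1ℚ - h) * a + h * a ≡ a
            lemma = solve-∀ ℚ-ring
    on-segment : OnSegment u v (move (mid u v) ε δ)
    on-segment = proj₂ (face _ K₊) (trans
      (flat c (mid u v) δ ε (subst (c · move (mid u v) ε δ ≤_) (sym c·mid≡c·u) (proj₁ (face _ K₊)))
                            (subst (c · move (mid u v) (- ε) δ ≤_) (sym c·mid≡c·u) (proj₁ (face _ K₋))))
      c·mid≡c·u)
    displacement : ∀ l → ε * δ l ≡ (proj₁ on-segment - ½) * (v l - u l)
    displacement l = trans (lemma₁ (u l) (v l) ½ (ε * δ l))
      (trans (cong (λ z → z - seg ½ u v l) (proj₂ (proj₂ (proj₂ on-segment)) l))
             (lemma₂ (u l) (v l) ½ (proj₁ on-segment)))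
      where lemma₁ : ∀ a b h y → y ≡ ((1ℚ - h) * a + h * b + y) - ((1ℚ - h) * a + h * b)
            lemma₁ = solve-∀ ℚ-ring
            lemma₂ : ∀ a b h t → ((1ℚ - t) * a + t * b) - ((1ℚ - h) * a + h * b) ≡ (t - h) * (b - a)
            lemma₂ = solve-∀ ℚ-ring

  edge-mid-directions-share-zeros : ∀ {K : Pt n → Set} {δ′} → IsEdge K u v →
    FreeDirection K (mid u v) δ → FreeDirection K (mid u v) δ′ →
    δ l ≢ 0ℚ → δ k ≡ 0ℚ → δ′ k ≡ 0ℚ
  edge-mid-directions-share-zeros {u = u} {v} {δ = δ} {l} {k} {δ′ = δ′} edge
    (ε , 0<ε , K₊ , K₋) (ε′ , 0<ε′ , K′₊ , K′₋) δl≢0 δk≡0 =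
    p*q≡0⇒q≡0 (<⇒≢0 0<ε′)
      (trans (proj₂ along′ k) (trans (cong (proj₁ along′ *_) vk-uk≡0) (*-zeroʳ (proj₁ along′))))
    where
    along = edge-mid-direction-parallel {δ = δ} {ε = ε} edge K₊ K₋
    along′ = edge-mid-direction-parallel {δ = δ′} {ε = ε′} edge K′₊ K′₋
    τ≢0 : proj₁ along ≢ 0ℚ
    τ≢0 τ≡0 = δl≢0 (p*q≡0⇒q≡0 (<⇒≢0 0<ε)
      (trans (proj₂ along l) (trans (cong (_* (v l - u l)) τ≡0) (*-zeroˡ (v l - u l)))))
    vk-uk≡0 : v k - u k ≡ 0ℚ
    vk-uk≡0 = p*q≡0⇒q≡0 τ≢0 (trans (sym (proj₂ along k)) (trans (cong (ε *_) δk≡0) (*-zeroʳ ε)))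

  InCube : Pt n → Set
  InCube x = ∀ i → (0ℚ ≤ x i) × (x i ≤ 1ℚ)

  Frac : ℚ → Set
  Frac y = (0ℚ < y) × (y < 1ℚ)

  frac? : ∀ y → Dec (Frac y)
  frac? y = (0ℚ <? y) ×-dec (y <? 1ℚ)

  ZeroOrOne : ℚ → Set
  ZeroOrOne y = (y ≡ 0ℚ) ⊎ (y ≡ 1ℚ)

  ¬frac⇒zeroOrOne : 0ℚ ≤ p → p ≤ 1ℚ → ¬ Frac p → ZeroOrOne p
  ¬frac⇒zeroOrOne {p} 0≤p p≤1 ¬frac with p ≟ 0ℚ | p ≟ 1ℚ
  ... | yes p≡0 | _ = inj₁ p≡0
  ... | no _ | yes p≡1 = inj₂ p≡1
  ... | no p≢0 | no p≢1 = ⊥-elim (¬frac (≤∧≢⇒< 0≤p (≢-sym p≢0) , ≤∧≢⇒< p≤1 p≢1))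

  zeroOrOne-≢-frac : ZeroOrOne p → Frac q → p ≢ q
  zeroOrOne-≢-frac (inj₁ refl) (0<q , _) p≡q = <-irrefl p≡q 0<q
  zeroOrOne-≢-frac (inj₂ refl) (_ , q<1) p≡q = <-irrefl (sym p≡q) q<1

  eS-zeroOrOne : ∀ (S : Subset n) l → ZeroOrOne (eS S l)
  eS-zeroOrOne S l with lookup S l
  ... | true = inj₂ refl
  ... | false = inj₁ refl

  eS-≢ : lookup S l ≢ lookup T l → eS S l ≢ eS T l
  eS-≢ {S = S} {l} {T} differ with lookup S l | lookup T l
  ... | true | true = ⊥-elim (differ refl)
  ... | false | false = ⊥-elim (differ refl)
  ... | true | false = λ ()
  ... | false | true = λ ()

  onesOf : Pt n → Subset n
  onesOf u = tabulate (λ l → does (u l ≟ 1ℚ))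

  integral-coordinate : ∀ (u : Pt n) {l} → 0ℚ ≤ u l → u l ≤ 1ℚ → ¬ Frac (u l) → u l ≡ eS (onesOf u) l
  integral-coordinate u {l} 0≤ul ul≤1 ¬frac
    rewrite lookup∘tabulate (λ l → does (u l ≟ 1ℚ)) l with u l ≟ 1ℚ
  ... | yes ul≡1 = ul≡1
  ... | no ul≢1 with ¬frac⇒zeroOrOne 0≤ul ul≤1 ¬frac
  ...   | inj₁ ul≡0 = ul≡0
  ...   | inj₂ ul≡1 = ⊥-elim (ul≢1 ul≡1)

  frac⇒∉onesOf : ∀ (u : Pt n) {k} → Frac (u k) → k ∉ onesOf u
  frac⇒∉onesOf u {k} (_ , uk<1) = lookup≡false⇒∉
    (trans (lookup∘tabulate (λ l → does (u l ≟ 1ℚ)) k) (dec-false (u k ≟ 1ℚ) (λ uk≡1 → <-irrefl uk≡1 uk<1)))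

  NearZero : (ℚ → Set) → Set
  NearZero P = Σ ℚ λ ε → (0ℚ < ε) × (∀ s → ∣ s ∣ ≤ ε → P s)

  nearZero-always : ∀ {P : ℚ → Set} → (∀ s → P s) → NearZero P
  nearZero-always always = 1ℚ , positive⁻¹ 1ℚ , λ s _ → always s

  nearZero-× : ∀ {P Q : ℚ → Set} → NearZero P → NearZero Q → NearZero (λ s → P s × Q s)
  nearZero-× (ε , 0<ε , P-near) (ε′ , 0<ε′ , Q-near) = ε ⊓ ε′ , 0<ε⊓ε′ ,
    λ s ∣s∣≤ → P-near s (≤-trans ∣s∣≤ (p⊓q≤p ε ε′)) , Q-near s (≤-trans ∣s∣≤ (p⊓q≤q ε ε′))
    where
    0<ε⊓ε′ : 0ℚ < ε ⊓ ε′
    0<ε⊓ε′ with ⊓-sel ε ε′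
    ... | inj₁ ≡ε = subst (0ℚ <_) (sym ≡ε) 0<ε
    ... | inj₂ ≡ε′ = subst (0ℚ <_) (sym ≡ε′) 0<ε′

  nearZero-∀ : ∀ {P : Fin n → ℚ → Set} → (∀ l → NearZero (P l)) → NearZero (λ s → ∀ l → P l s)
  nearZero-∀ {zero} near = nearZero-always (λ _ ())
  nearZero-∀ {suc n} near with nearZero-× (near zero) (nearZero-∀ (λ l → near (suc l)))
  ... | ε , 0<ε , both = ε , 0<ε , λ where
    s ∣s∣≤ε zero → proj₁ (both s ∣s∣≤ε)
    s ∣s∣≤ε (suc l) → proj₂ (both s ∣s∣≤ε) l

  nearZero-small : 0ℚ < q → ∀ c → NearZero (λ s → ∣ s * c ∣ ≤ q)
  nearZero-small {q} 0<q c = ε , 0<ε , small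
    where
    D = ∣ c ∣ + 1ℚ
    0<D : 0ℚ < D
    0<D = subst (0ℚ <_) (+-comm 1ℚ ∣ c ∣) (0<+0≤⇒0< (positive⁻¹ 1ℚ) (0≤∣p∣ c))
    ε = proj₁ (solve-linear (<⇒≢0 0<D) q)
    εD≡q : ε * D ≡ q
    εD≡q = proj₂ (solve-linear (<⇒≢0 0<D) q)
    0<ε : 0ℚ < ε
    0<ε = *-cancelʳ-<-nonNeg D {{nonNegative (<⇒≤ 0<D)}}
            (subst₂ _<_ (sym (*-zeroˡ D)) (sym εD≡q) 0<q)
    small : ∀ s → ∣ s ∣ ≤ ε → ∣ s * c ∣ ≤ q
    small s ∣s∣≤ε = subst (_≤ q) (sym (∣p*q∣≡∣p∣*∣q∣ s c))
      (≤-trans (*-monoʳ-≤-nonNeg ∣ c ∣ {{nonNegative (0≤∣p∣ c)}} ∣s∣≤ε)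
               (subst (ε * ∣ c ∣ ≤_) εD≡q (≤-by-diff ε (lemma ε ∣ c ∣) (<⇒≤ 0<ε))))
      where lemma : ∀ ε a → ε * (a + 1ℚ) - ε * a ≡ ε
            lemma = solve-∀ ℚ-ring

  nearZero-below : p < q → ∀ c → NearZero (λ s → p + s * c ≤ q)
  nearZero-below {p} {q} p<q c = ε , 0<ε , below
    where
    small = nearZero-small (p<q⇒0<q-p p<q) c
    ε = proj₁ small
    0<ε = proj₁ (proj₂ small)
    lemma : ∀ p q y a → q - (p + y) ≡ (q - p - a) + (a - y)
    lemma = solve-∀ ℚ-ring
    below : ∀ s → ∣ s ∣ ≤ ε → p + s * c ≤ q
    below s ∣s∣≤ε = ≤-by-diff ((q - p - ∣ s * c ∣) + (∣ s * c ∣ - s * c)) (lemma p q (s * c) ∣ s * c ∣)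
      (0≤+0≤⇒0≤ (p≤q⇒0≤q-p (proj₂ (proj₂ small) s ∣s∣≤ε))
                (p≤q⇒0≤q-p (p≤∣p∣ (s * c))))

  nearZero-above : p < q → ∀ c → NearZero (λ s → p ≤ q + s * c)
  nearZero-above {p} {q} p<q c = ε , 0<ε , above
    where
    small = nearZero-small (p<q⇒0<q-p p<q) c
    ε = proj₁ small
    0<ε = proj₁ (proj₂ small)
    lemma : ∀ p q y a → q + y - p ≡ (q - p - a) + (y - - a)
    lemma = solve-∀ ℚ-ring
    above : ∀ s → ∣ s ∣ ≤ ε → p ≤ q + s * c
    above s ∣s∣≤ε = ≤-by-diff ((q - p - ∣ s * c ∣) + (s * c - - ∣ s * c ∣)) (lemma p q (s * c) ∣ s * c ∣)
      (0≤+0≤⇒0≤ (p≤q⇒0≤q-p (proj₂ (proj₂ small) s ∣s∣≤ε))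
                (p≤q⇒0≤q-p (-[∣p∣]≤p (s * c))))

  Supported : Pt n → (Fin n → Set) → Set
  Supported δ F = ∀ l → δ l ≡ 0ℚ ⊎ F l

  supported-map : ∀ {F G : Fin n → Set} → (∀ {l} → F l → G l) → Supported δ F → Supported δ G
  supported-map F⇒G supported l with supported l
  ... | inj₁ δl≡0 = inj₁ δl≡0
  ... | inj₂ Fl = inj₂ (F⇒G Fl)

  supported-nonzero : ∀ {F : Fin n → Set} → Supported δ F → δ l ≢ 0ℚ → F l
  supported-nonzero {l = l} supported δl≢0 with supported l
  ... | inj₁ δl≡0 = ⊥-elim (δl≢0 δl≡0)
  ... | inj₂ Fl = Fl

  e-supported : ∀ (k : Fin n) → Supported (e k) (_≡ k)
  e-supported k l with l ≟ᶠ k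
  ... | yes l≡k = inj₂ l≡k
  ... | no l≢k = inj₁ (e-≢ l≢k)

  mid-frac-left : ∀ {u v : Pt n} {l} → 0ℚ ≤ v l → v l ≤ 1ℚ → Frac (u l) → Frac (mid u v l)
  mid-frac-left {u = u} {v} {l} 0≤vl vl≤1 (0<ul , ul<1) =
    0<+0≤⇒0< (0<*0<⇒0< 0<½ 0<ul) (0≤*0≤⇒0≤ (<⇒≤ 0<½) 0≤vl) ,
    <-by-diff ((1ℚ - ½) * (1ℚ - u l) + ½ * (1ℚ - v l)) (lemma (u l) (v l) ½)
      (0<+0≤⇒0< (0<*0<⇒0< 0<½ (p<q⇒0<q-p ul<1)) (0≤*0≤⇒0≤ (<⇒≤ 0<½) (p≤q⇒0≤q-p vl≤1)))
    where lemma : ∀ x y h → 1ℚ - ((1ℚ - h) * x + h * y) ≡ (1ℚ - h) * (1ℚ - x) + h * (1ℚ - y)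
          lemma = solve-∀ ℚ-ring

  mid-frac-right : ∀ {u v : Pt n} {l} → 0ℚ ≤ u l → u l ≤ 1ℚ → Frac (v l) → Frac (mid u v l)
  mid-frac-right {u = u} {v} {l} 0≤ul ul≤1 fracᵥ =
    subst Frac (mid-comm v u l) (mid-frac-left {u = v} {v = u} {l = l} 0≤ul ul≤1 fracᵥ)

  mid-frac-differ : ∀ {u v : Pt n} {l S T} → u l ≡ eS S l → v l ≡ eS T l → lookup S l ≢ lookup T l →
                    Frac (mid u v l)
  mid-frac-differ {u = u} {v} {l} {S} {T} ul≡ vl≡ differ =
    subst Frac (sym (cong₂ (λ x y → (1ℚ - ½) * x + ½ * y) ul≡ vl≡)) (half (lookup S l) (lookup T l) differ)
    where
    half : ∀ x y → x ≢ y → Frac ((1ℚ - ½) * (if x then 1ℚ else 0ℚ) + ½ * (if y then 1ℚ else 0ℚ))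
    half true true x≢y = ⊥-elim (x≢y refl)
    half false false x≢y = ⊥-elim (x≢y refl)
    half true false _ = 0<½ , ½<1
    half false true _ = 0<½ , ½<1

  mid-integral⇒agree : ∀ {u v : Pt n} {l S T} → u l ≡ eS S l → v l ≡ eS T l → ¬ Frac (mid u v l) →
                       lookup S l ≡ lookup T l
  mid-integral⇒agree {u = u} {v} {l} {S} {T} ul≡ vl≡ ¬frac with lookup S l ≟ᵇ lookup T l
  ... | yes agree = agree
  ... | no differ = ⊥-elim (¬frac (mid-frac-differ {u = u} {v} {l} {S} {T} ul≡ vl≡ differ))

  OnFace : Subset n → Fin n → Fin n → Pt n → Set
  OnFace R i j x = ∀ l → l ≢ i → l ≢ j → x l ≡ eS R l

  -- Minus the ℓ¹-distance to e_R over the coordinates other than i and j, up to a constant: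
  -- on the cube it is maximal exactly on the face through e_R that frees i and j.
  faceFunctional : Subset n → Fin n → Fin n → Pt n
  faceFunctional R i j l with l ≟ᶠ i | l ≟ᶠ j
  ... | yes _ | _ = 0ℚ
  ... | no _ | yes _ = 0ℚ
  ... | no _ | no _ = if lookup R l then 1ℚ else - 1ℚ

  private
    faceFunctional-term-≤ : ∀ (R : Subset n) i j {x : Pt n} l → 0ℚ ≤ x l → x l ≤ 1ℚ →
      faceFunctional R i j l * x l ≤ faceFunctional R i j l * eS R l
    faceFunctional-term-≤ R i j {x} l 0≤xl xl≤1 with l ≟ᶠ i | l ≟ᶠ j
    ... | yes _ | _ = ≤-reflexive (trans (*-zeroˡ (x l)) (sym (*-zeroˡ (eS R l))))
    ... | no _ | yes _ = ≤-reflexive (trans (*-zeroˡ (x l)) (sym (*-zeroˡ (eS R l))))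
    ... | no _ | no _ with lookup R l
    ...   | true = ≤-by-diff (1ℚ - x l) (lemma (x l)) (p≤q⇒0≤q-p xl≤1)
      where lemma : ∀ x → 1ℚ * 1ℚ - 1ℚ * x ≡ 1ℚ - x
            lemma = solve-∀ ℚ-ring
    ...   | false = ≤-by-diff (x l) (lemma (x l)) 0≤xl
      where lemma : ∀ x → - 1ℚ * 0ℚ - - 1ℚ * x ≡ x
            lemma = solve-∀ ℚ-ring

    faceFunctional-term-≡ : ∀ (R : Subset n) i j {x : Pt n} l → l ≢ i → l ≢ j →
      faceFunctional R i j l * x l ≡ faceFunctional R i j l * eS R l → x l ≡ eS R l
    faceFunctional-term-≡ R i j {x} l l≢i l≢j eq with l ≟ᶠ i | l ≟ᶠ j
    ... | yes l≡i | _ = ⊥-elim (l≢i l≡i)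
    ... | no _ | yes l≡j = ⊥-elim (l≢j l≡j)
    ... | no _ | no _ with lookup R l
    ...   | true = trans (sym (*-identityˡ (x l))) eq
    ...   | false = trans (lemma (x l)) (cong -_ eq)
      where lemma : ∀ x → x ≡ - (- 1ℚ * x)
            lemma = solve-∀ ℚ-ring

    faceFunctional-term-onFace : ∀ (R : Subset n) i j {x : Pt n} → OnFace R i j x → ∀ l →
      faceFunctional R i j l * x l ≡ faceFunctional R i j l * eS R l
    faceFunctional-term-onFace R i j {x} onFace l with l ≟ᶠ i | l ≟ᶠ j
    ... | yes _ | _ = trans (*-zeroˡ (x l)) (sym (*-zeroˡ (eS R l)))
    ... | no _ | yes _ = trans (*-zeroˡ (x l)) (sym (*-zeroˡ (eS R l)))
    ... | no l≢i | no l≢j = cong ((if lookup R l then 1ℚ else - 1ℚ) *_) (onFace l l≢i l≢j)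

  faceFunctional-≤ : ∀ (R : Subset n) i j → InCube x → faceFunctional R i j · x ≤ faceFunctional R i j · eS R
  faceFunctional-≤ {x = x} R i j x∈cube =
    sum-mono-≤ (λ l → faceFunctional-term-≤ R i j {x} l (proj₁ (x∈cube l)) (proj₂ (x∈cube l)))

  faceFunctional-≡⇒onFace : ∀ (R : Subset n) i j → InCube x →
    faceFunctional R i j · x ≡ faceFunctional R i j · eS R → OnFace R i j x
  faceFunctional-≡⇒onFace {x = x} R i j x∈cube eq l l≢i l≢j = faceFunctional-term-≡ R i j {x} l l≢i l≢j
    (sum-mono-≤-equality (λ l → faceFunctional-term-≤ R i j {x} l (proj₁ (x∈cube l)) (proj₂ (x∈cube l))) eq l)

  onFace⇒faceFunctional-≡ : ∀ (R : Subset n) i j → OnFace R i j x →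
    faceFunctional R i j · x ≡ faceFunctional R i j · eS R
  onFace⇒faceFunctional-≡ {x = x} R i j onFace = sum-cong (faceFunctional-term-onFace R i j {x} onFace)

  onFace-segment-off : ∀ {R : Subset n} {i j t} → OnFace R i j u → OnFace R i j v → OnFace R i j x →
                       l ≢ i → l ≢ j → x l ≡ seg t u v l
  onFace-segment-off {u = u} {v} {x} {l} {R} {t = t} onFaceᵤ onFaceᵥ onFaceₓ l≢i l≢j =
    trans (onFaceₓ l l≢i l≢j) (trans (lemma (eS R l) t)
      (sym (cong₂ (λ p q → (1ℚ - t) * p + t * q) (onFaceᵤ l l≢i l≢j) (onFaceᵥ l l≢i l≢j))))
    where lemma : ∀ p t → p ≡ (1ℚ - t) * p + t * p
          lemma = solve-∀ ℚ-ring

  onFace-segment : ∀ {R : Subset n} {i j t} → OnFace R i j u → OnFace R i j v → OnFace R i j x →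
                   x i ≡ seg t u v i → x j ≡ seg t u v j → x ≈ seg t u v
  onFace-segment {R = R} {i} {j} {t} onFaceᵤ onFaceᵥ onFaceₓ xi≡ xj≡ l with l ≟ᶠ i | l ≟ᶠ j
  ... | yes refl | _ = xi≡
  ... | no _ | yes refl = xj≡
  ... | no l≢i | no l≢j = onFace-segment-off {R = R} {t = t} onFaceᵤ onFaceᵥ onFaceₓ l≢i l≢j

  segment-parameter : ∀ {u v : Pt n} {l} → u l ≢ v l → ∀ y → Σ ℚ λ t → y ≡ seg t u v l
  segment-parameter {u = u} {v} {l} ul≢vl y = t , (begin
      y                              ≡⟨ lemma₁ (u l) y ⟩
      u l + (y - u l)                ≡⟨ cong (u l +_) (sym t*[v-u]≡) ⟩
      u l + t * (v l - u l)          ≡⟨ lemma₂ t (u l) (v l) ⟩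
      (1ℚ - t) * u l + t * v l       ∎)
    where
    open ≡-Reasoning
    lemma₁ : ∀ p q → q ≡ p + (q - p)
    lemma₁ = solve-∀ ℚ-ring
    lemma₂ : ∀ t p q → p + t * (q - p) ≡ (1ℚ - t) * p + t * q
    lemma₂ = solve-∀ ℚ-ring
    v-u≢0 : v l - u l ≢ 0ℚ
    v-u≢0 eq = ul≢vl (sym (trans (lemma₁ (u l) (v l)) (trans (cong (u l +_) eq) (+-identityʳ (u l)))))
    t = proj₁ (solve-linear v-u≢0 (y - u l))
    t*[v-u]≡ = proj₂ (solve-linear v-u≢0 (y - u l))

  module HalfspaceCut (a : Pt n) (ρ : ℚ) where

    InCut : Pt n → Set
    InCut x = InCube x × (a · x ≤ ρ)

    convex : ∀ {t} → InCut u → InCut v → 0ℚ ≤ t → t ≤ 1ℚ → InCut (seg t u v)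
    convex {u = u} {v} {t} (u∈cube , a·u≤ρ) (v∈cube , a·v≤ρ) 0≤t t≤1 = in-cube , below
      where
      0≤1-t = p≤q⇒0≤q-p t≤1
      in-cube : InCube (seg t u v)
      in-cube l =
        0≤+0≤⇒0≤ (0≤*0≤⇒0≤ 0≤1-t (proj₁ (u∈cube l))) (0≤*0≤⇒0≤ 0≤t (proj₁ (v∈cube l))) ,
        ≤-by-diff ((1ℚ - t) * (1ℚ - u l) + t * (1ℚ - v l)) (lemma t (u l) (v l))
          (0≤+0≤⇒0≤ (0≤*0≤⇒0≤ 0≤1-t (p≤q⇒0≤q-p (proj₂ (u∈cube l))))
                    (0≤*0≤⇒0≤ 0≤t (p≤q⇒0≤q-p (proj₂ (v∈cube l)))))
        where lemma : ∀ t a b → 1ℚ - ((1ℚ - t) * a + t * b) ≡ (1ℚ - t) * (1ℚ - a) + t * (1ℚ - b)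
              lemma = solve-∀ ℚ-ring
      below : a · seg t u v ≤ ρ
      below = subst (_≤ ρ) (sym (·-seg a t u v))
        (≤-by-diff ((1ℚ - t) * (ρ - a · u) + t * (ρ - a · v)) (lemma t (a · u) (a · v) ρ)
          (0≤+0≤⇒0≤ (0≤*0≤⇒0≤ 0≤1-t (p≤q⇒0≤q-p a·u≤ρ)) (0≤*0≤⇒0≤ 0≤t (p≤q⇒0≤q-p a·v≤ρ))))
        where lemma : ∀ t a b r → r - ((1ℚ - t) * a + t * b) ≡ (1ℚ - t) * (r - a) + t * (r - b)
              lemma = solve-∀ ℚ-ring

    free-direction : InCut x → Supported δ (λ l → Frac (x l)) → (a · δ ≡ 0ℚ ⊎ a · x < ρ) →
                     FreeDirection InCut x δ
    free-direction {x = x} {δ} (x∈cube , a·x≤ρ) supported parallel-or-slack =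
      ε , 0<ε , stays ε ∣ε∣≤ε , stays (- ε) (subst (_≤ ε) (sym (∣-p∣≡∣p∣ ε)) ∣ε∣≤ε)
      where
      coordinate : ∀ l → NearZero (λ s → (0ℚ ≤ move x s δ l) × (move x s δ l ≤ 1ℚ))
      coordinate l with supported l
      ... | inj₁ δl≡0 = nearZero-always λ s →
        subst (λ z → (0ℚ ≤ z) × (z ≤ 1ℚ)) (sym (trans (cong (λ z → x l + s * z) δl≡0)
          (trans (cong (x l +_) (*-zeroʳ s)) (+-identityʳ (x l))))) (x∈cube l)
      ... | inj₂ (0<xl , xl<1) = nearZero-× (nearZero-above 0<xl (δ l)) (nearZero-below xl<1 (δ l))
      halfspace : (a · δ ≡ 0ℚ ⊎ a · x < ρ) → NearZero (λ s → a · move x s δ ≤ ρ)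
      halfspace (inj₁ a·δ≡0) = nearZero-always λ s →
        subst (_≤ ρ) (sym (trans (·-move a x s δ) (trans (cong (λ z → a · x + s * z) a·δ≡0)
          (trans (cong (a · x +_) (*-zeroʳ s)) (+-identityʳ (a · x)))))) a·x≤ρ
      halfspace (inj₂ a·x<ρ) = proj₁ near , proj₁ (proj₂ near) ,
        λ s ∣s∣≤ε → subst (_≤ ρ) (sym (·-move a x s δ)) (proj₂ (proj₂ near) s ∣s∣≤ε)
        where near = nearZero-below a·x<ρ (a · δ)
      near : NearZero (λ s → InCut (move x s δ))
      near = nearZero-× (nearZero-∀ coordinate) (halfspace parallel-or-slack)
      ε = proj₁ near
      0<ε = proj₁ (proj₂ near)
      stays = proj₂ (proj₂ near)
      ∣ε∣≤ε : ∣ ε ∣ ≤ ε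
      ∣ε∣≤ε = ≤-reflexive (0≤p⇒∣p∣≡p (<⇒≤ 0<ε))

    kernelPair : Fin n → Fin n → Pt n
    kernelPair i j l = a j * e i l + (- a i) * e j l

    a·kernelPair≡0 : ∀ i j → a · kernelPair i j ≡ 0ℚ
    a·kernelPair≡0 i j = begin
      a · kernelPair i j
        ≡⟨ ·-+ a (λ l → a j * e i l) (λ l → (- a i) * e j l) ⟩
      a · (λ l → a j * e i l) + a · (λ l → (- a i) * e j l)
        ≡⟨ cong₂ _+_ (·-* a (a j) (e i)) (·-* a (- a i) (e j)) ⟩
      a j * (a · e i) + (- a i) * (a · e j)
        ≡⟨ cong₂ (λ x y → a j * x + (- a i) * y) (·-e a i) (·-e a j) ⟩
      a j * a i + (- a i) * a j
        ≡⟨ lemma (a i) (a j) ⟩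
      0ℚ ∎
      where open ≡-Reasoning
            lemma : ∀ x y → y * x + (- x) * y ≡ 0ℚ
            lemma = solve-∀ ℚ-ring

    kernelPair-off : l ≢ i → l ≢ j → kernelPair i j l ≡ 0ℚ
    kernelPair-off {l} {i} {j} l≢i l≢j =
      trans (cong₂ (λ x y → a j * x + (- a i) * y) (e-≢ l≢i) (e-≢ l≢j)) (lemma (a i) (a j))
      where lemma : ∀ x y → y * 0ℚ + (- x) * 0ℚ ≡ 0ℚ
            lemma = solve-∀ ℚ-ring

    kernelPair-supported : ∀ i j → Supported (kernelPair i j) (λ l → l ≡ i ⊎ l ≡ j)
    kernelPair-supported i j l with l ≟ᶠ i | l ≟ᶠ j
    ... | yes l≡i | _ = inj₂ (inj₁ l≡i)
    ... | no _ | yes l≡j = inj₂ (inj₂ l≡j)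
    ... | no l≢i | no l≢j = inj₁ (kernelPair-off l≢i l≢j)

    kernelPair-at-j : i ≢ j → kernelPair i j j ≡ - a i
    kernelPair-at-j {i} {j} i≢j = trans (cong₂ (λ x y → a j * x + (- a i) * y) (e-≢ (≢-sym i≢j)) (e-same j))
                                        (lemma (a i) (a j))
      where lemma : ∀ x y → y * 0ℚ + (- x) * 1ℚ ≡ - x
            lemma = solve-∀ ℚ-ring

    nonzero-kernel-direction : i ≢ j →
      Σ (Pt n) λ δ → (a · δ ≡ 0ℚ) × Supported δ (λ l → l ≡ i ⊎ l ≡ j) × Σ (Fin n) λ k → δ k ≢ 0ℚ
    nonzero-kernel-direction {i} {j} i≢j with a i ≟ 0ℚ
    ... | yes aᵢ≡0 = e i , trans (·-e a i) aᵢ≡0 , supported-map inj₁ (e-supported i) ,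
                     i , (λ eq → 1≢0 (trans (sym (e-same i)) eq))
    ... | no aᵢ≢0 = kernelPair i j , a·kernelPair≡0 i j , kernelPair-supported i j ,
                    j , (λ eq → aᵢ≢0 (neg-injective (trans (sym (kernelPair-at-j i≢j)) eq)))

    vertex-frac⇒tight : InCut u → Exposes InCut c u → Frac (u k) → a · u ≡ ρ
    vertex-frac⇒tight {u = u} {c} {k} u∈K exposes frac with a · u ≟ ρ
    ... | yes a·u≡ρ = a·u≡ρ
    ... | no a·u≢ρ = ⊥-elim (1≢0 (trans (sym (e-same k)) (exposed-no-free-direction {c = c} exposes free k)))
      where free = free-direction u∈K (supported-map (λ where refl → frac) (e-supported k))
                                  (inj₂ (≤∧≢⇒< (proj₂ u∈K) a·u≢ρ))

    vertex-frac-unique : InCut u → Exposes InCut c u → Frac (u i) → Frac (u j) → i ≡ j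
    vertex-frac-unique {u = u} {c} {i} {j} u∈K exposes fracᵢ fracⱼ with i ≟ᶠ j
    ... | yes i≡j = i≡j
    ... | no i≢j with nonzero-kernel-direction i≢j
    ...   | δ , a·δ≡0 , supported , k , δk≢0 = ⊥-elim (δk≢0 (exposed-no-free-direction {c = c} exposes free k))
      where
      frac : ∀ {l} → l ≡ i ⊎ l ≡ j → Frac (u l)
      frac (inj₁ refl) = fracᵢ
      frac (inj₂ refl) = fracⱼ
      free = free-direction u∈K (supported-map frac supported) (inj₁ a·δ≡0)

    CutPoint : Subset n → Fin n → Pt n → Set
    CutPoint S k v = (k ∉ S) × Σ ℚ λ t → (t * a k ≡ ρ - a · eS S) × (v ≈ move (eS S) t (e k))

    cut-point-intro : k ∉ S → a · x ≡ ρ → x ≈ move (eS S) (x k) (e k) → CutPoint S k x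
    cut-point-intro {k = k} {S} {x} k∉S a·x≡ρ x≈ = k∉S , x k , t-eq , x≈
      where
      t-eq : x k * a k ≡ ρ - a · eS S
      t-eq = begin
        x k * a k                                   ≡⟨ lemma (a · eS S) (x k * a k) ⟩
        a · eS S + x k * a k - a · eS S             ≡⟨ cong (λ z → a · eS S + x k * z - a · eS S) (sym (·-e a k)) ⟩
        a · eS S + x k * (a · e k) - a · eS S       ≡⟨ cong (_- a · eS S) (sym (·-move a (eS S) (x k) (e k))) ⟩
        a · move (eS S) (x k) (e k) - a · eS S      ≡⟨ cong (_- a · eS S) (sym (·-cong a x≈)) ⟩
        a · x - a · eS S                            ≡⟨ cong (_- a · eS S) a·x≡ρ ⟩
        ρ - a · eS S                                ∎
        where open ≡-Reasoning
              lemma : ∀ p q → q ≡ p + q - p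
              lemma = solve-∀ ℚ-ring

    VertexForm : Pt n → Set
    VertexForm u = (Σ (Subset n) λ S → u ≈ eS S) ⊎ (Σ (Subset n) λ S → Σ (Fin n) λ k → CutPoint S k u)

    vertex-form : ∀ {c u} → InCut u → Exposes InCut c u → VertexForm u
    vertex-form {c} {u} u∈K exposes with any? (λ k → frac? (u k))
    ... | no no-frac = inj₁ (onesOf u , λ l → integral l (λ frac → no-frac (l , frac)))
      where integral : ∀ l → ¬ Frac (u l) → u l ≡ eS (onesOf u) l
            integral l = integral-coordinate u (proj₁ (proj₁ u∈K l)) (proj₂ (proj₁ u∈K l))
    ... | yes (k , fracₖ) = inj₂ (onesOf u , k ,
          cut-point-intro k∉S (vertex-frac⇒tight {c = c} u∈K exposes fracₖ) u≈)
      where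
      k∉S = frac⇒∉onesOf u fracₖ
      u≈ : u ≈ move (eS (onesOf u)) (u k) (e k)
      u≈ l with l ≟ᶠ k
      ... | yes refl = sym (trans (cong₂ _+_ (eS-false {S = onesOf u} (∉⇒lookup≡false k∉S))
                                            (trans (cong (u k *_) (e-same k)) (*-identityʳ (u k))))
                                  (+-identityˡ (u k)))
      ... | no l≢k = trans
        (integral-coordinate u (proj₁ (proj₁ u∈K l)) (proj₂ (proj₁ u∈K l))
           (λ fracₗ → l≢k (sym (vertex-frac-unique {c = c} u∈K exposes fracₖ fracₗ))))
        (sym (trans (cong (λ z → eS (onesOf u) l + u k * z) (e-≢ l≢k))
                    (trans (cong (eS (onesOf u) l +_) (*-zeroʳ (u k))) (+-identityʳ _))))

    mid∈cut : InCut u → InCut v → InCut (mid u v)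
    mid∈cut u∈K v∈K = convex u∈K v∈K (<⇒≤ 0<½) (<⇒≤ ½<1)

    mid-slack : a · u < ρ → a · v ≤ ρ → a · mid u v < ρ
    mid-slack {u = u} {v} a·u<ρ a·v≤ρ = subst (_< ρ) (sym (·-seg a ½ u v))
      (<-by-diff ((1ℚ - ½) * (ρ - a · u) + ½ * (ρ - a · v)) (lemma (a · u) (a · v) ρ ½)
        (0<+0≤⇒0< (0<*0<⇒0< 0<½ (p<q⇒0<q-p a·u<ρ)) (0≤*0≤⇒0≤ (<⇒≤ 0<½) (p≤q⇒0≤q-p a·v≤ρ))))
      where lemma : ∀ x y r h → r - ((1ℚ - h) * x + h * y) ≡ (1ℚ - h) * (r - x) + h * (r - y)
            lemma = solve-∀ ℚ-ring

    edge-mid-frac-unique : IsEdge InCut u v → a · mid u v < ρ →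
                           Frac (mid u v k) → Frac (mid u v l) → l ≡ k
    edge-mid-frac-unique {u = u} {v} {k} {l} edge slack fracₖ fracₗ with l ≟ᶠ k
    ... | yes l≡k = l≡k
    ... | no l≢k = ⊥-elim (1≢0 (trans (sym (e-same l))
        (edge-mid-directions-share-zeros edge (along fracₖ) (along fracₗ) (1≢0 ∘′ trans (sym (e-same k))) (e-≢ l≢k))))
      where
      along : ∀ {k} → Frac (mid u v k) → FreeDirection InCut (mid u v) (e k)
      along {k} frac = free-direction (mid∈cut (proj₁ edge) (proj₁ (proj₂ edge)))
                                      (supported-map (λ where refl → frac) (e-supported k)) (inj₂ slack)

    edge-mid-frac-pair : IsEdge InCut u v → i ≢ j →
                         Frac (mid u v i) → Frac (mid u v j) → Frac (mid u v l) → l ≡ i ⊎ l ≡ j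
    edge-mid-frac-pair {u = u} {v} {i} {j} {l} edge i≢j fracᵢ fracⱼ fracₗ with l ≟ᶠ i | l ≟ᶠ j
    ... | yes l≡i | _ = inj₁ l≡i
    ... | no _ | yes l≡j = inj₂ l≡j
    ... | no l≢i | no l≢j = ⊥-elim (non-parallel (a i ≟ 0ℚ))
      where
      frac : ∀ {k} → k ≡ i ⊎ k ≡ j ⊎ k ≡ l → Frac (mid u v k)
      frac (inj₁ refl) = fracᵢ
      frac (inj₂ (inj₁ refl)) = fracⱼ
      frac (inj₂ (inj₂ refl)) = fracₗ
      free : ∀ {δ} → a · δ ≡ 0ℚ → Supported δ (λ k → k ≡ i ⊎ k ≡ j ⊎ k ≡ l) → FreeDirection InCut (mid u v) δ
      free a·δ≡0 supported = free-direction (mid∈cut (proj₁ edge) (proj₁ (proj₂ edge)))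
                                            (supported-map frac supported) (inj₁ a·δ≡0)
      -- With aᵢ = 0 the direction eᵢ is parallel to the hyperplane; otherwise eliminate coordinate i.
      non-parallel : Dec (a i ≡ 0ℚ) → ⊥
      non-parallel (yes aᵢ≡0) with nonzero-kernel-direction (≢-sym l≢j)
      ... | δ , a·δ≡0 , supported , k , δk≢0 = δk≢0 (edge-mid-directions-share-zeros edge
            (free (trans (·-e a i) aᵢ≡0) (supported-map inj₁ (e-supported i)))
            (free a·δ≡0 (supported-map inj₂ supported))
            (1≢0 ∘′ trans (sym (e-same i))) (e-≢ k≢i))
        where k≢i : k ≢ i
              k≢i k≡i with supported-nonzero supported δk≢0
              ... | inj₁ k≡j = i≢j (trans (sym k≡i) k≡j)
              ... | inj₂ k≡l = l≢i (trans (sym k≡l) k≡i)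
      non-parallel (no aᵢ≢0) = -aᵢ≢0 (trans (sym (kernelPair-at-j (l≢i ∘′ sym))) (edge-mid-directions-share-zeros edge
            (free (a·kernelPair≡0 i j) (supported-map (λ where (inj₁ k≡i) → inj₁ k≡i ; (inj₂ k≡j) → inj₂ (inj₁ k≡j))
                                                      (kernelPair-supported i j)))
            (free (a·kernelPair≡0 i l) (supported-map (λ where (inj₁ k≡i) → inj₁ k≡i ; (inj₂ k≡l) → inj₂ (inj₂ k≡l))
                                                      (kernelPair-supported i l)))
            (λ eq → -aᵢ≢0 (trans (sym (kernelPair-at-j i≢j)) eq)) (kernelPair-off l≢i l≢j)))
        where -aᵢ≢0 : - a i ≢ 0ℚ
              -aᵢ≢0 eq = aᵢ≢0 (neg-injective eq)

    cut-coordinate : (cut : CutPoint S k v) → v k ≡ proj₁ (proj₂ cut)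
    cut-coordinate {S} {k} {v} (k∉S , t , _ , v≈) = trans (v≈ k)
      (trans (cong₂ _+_ (eS-false {S = S} (∉⇒lookup≡false k∉S)) (trans (cong (t *_) (e-same k)) (*-identityʳ t)))
             (+-identityˡ t))

    cut-off : CutPoint S k v → l ≢ k → v l ≡ eS S l
    cut-off {S} {k} {v} {l} (_ , t , _ , v≈) l≢k = trans (v≈ l)
      (trans (cong (λ z → eS S l + t * z) (e-≢ l≢k)) (trans (cong (eS S l +_) (*-zeroʳ t)) (+-identityʳ _)))

    cut-tight : CutPoint S k v → a · v ≡ ρ
    cut-tight {S} {k} {v} (_ , t , t*aₖ≡ , v≈) = begin
      a · v                          ≡⟨ ·-cong a v≈ ⟩
      a · move (eS S) t (e k)        ≡⟨ ·-move a (eS S) t (e k) ⟩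
      a · eS S + t * (a · e k)       ≡⟨ cong (λ z → a · eS S + t * z) (·-e a k) ⟩
      a · eS S + t * a k             ≡⟨ cong (a · eS S +_) t*aₖ≡ ⟩
      a · eS S + (ρ - a · eS S)      ≡⟨ lemma (a · eS S) ρ ⟩
      ρ                              ∎
      where open ≡-Reasoning
            lemma : ∀ p r → p + (r - p) ≡ r
            lemma = solve-∀ ℚ-ring

    edge-of-face : ∀ {R i j} → InCut u → InCut v → ¬ (u ≈ v) → OnFace R i j u → OnFace R i j v →
                   (∀ x → InCut x → OnFace R i j x → OnSegment u v x) → IsEdge InCut u v
    edge-of-face {u} {v} {R} {i} {j} u∈K v∈K u≉v onFaceᵤ onFaceᵥ segment =
      u∈K , v∈K , u≉v , f , trans (f·≡ onFaceᵤ) (sym (f·≡ onFaceᵥ)) ,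
      λ x x∈K → subst (f · x ≤_) (sym (f·≡ onFaceᵤ)) (faceFunctional-≤ R i j (proj₁ x∈K)) ,
                λ eq → segment x x∈K (faceFunctional-≡⇒onFace R i j (proj₁ x∈K) (trans eq (f·≡ onFaceᵤ)))
      where
      f = faceFunctional R i j
      f·≡ : ∀ {x} → OnFace R i j x → f · x ≡ f · eS R
      f·≡ = onFace⇒faceFunctional-≡ R i j

    edge-of-tight-face : ∀ {R i j} → InCut u → InCut v → ¬ (u ≈ v) → OnFace R i j u → OnFace R i j v →
      a · u ≡ ρ → a · v ≡ ρ → (∀ x → InCut x → OnFace R i j x → a · x ≡ ρ → OnSegment u v x) → IsEdge InCut u v
    edge-of-tight-face {u} {v} {R} {i} {j} u∈K v∈K u≉v onFaceᵤ onFaceᵥ a·u≡ρ a·v≡ρ segment =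
      u∈K , v∈K , u≉v , f+a , trans (f+a·≡ onFaceᵤ a·u≡ρ) (sym (f+a·≡ onFaceᵥ a·v≡ρ)) ,
      λ x x∈K → subst₂ _≤_ (sym (+-· f a x)) (sym (f+a·≡ onFaceᵤ a·u≡ρ)) (+-mono-≤ (f≤ x∈K) (proj₂ x∈K)) ,
                λ eq → on-segment x∈K (+-mono-≤-equality (f≤ x∈K) (proj₂ x∈K)
                                         (trans (sym (+-· f a x)) (trans eq (f+a·≡ onFaceᵤ a·u≡ρ))))
      where
      f = faceFunctional R i j
      f+a : Pt _
      f+a l = f l + a l
      f≤ : ∀ {x} → InCut x → f · x ≤ f · eS R
      f≤ x∈K = faceFunctional-≤ R i j (proj₁ x∈K)
      f+a·≡ : ∀ {x} → OnFace R i j x → a · x ≡ ρ → f+a · x ≡ f · eS R + ρ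
      f+a·≡ {x} onFace a·x≡ρ = trans (+-· f a x) (cong₂ _+_ (onFace⇒faceFunctional-≡ R i j onFace) a·x≡ρ)
      on-segment : ∀ {x} → InCut x → (f · x ≡ f · eS R) × (a · x ≡ ρ) → OnSegment u v x
      on-segment {x} x∈K (f·x≡ , a·x≡ρ) = segment x x∈K (faceFunctional-≡⇒onFace R i j (proj₁ x∈K) f·x≡) a·x≡ρ

    BoundedBelow : Pt n → Pt n → Set
    BoundedBelow u v = ∀ x t → InCut x → x ≈ seg t u v → 0ℚ ≤ t

    facet-bounded-below : InCube v → ZeroOrOne (u l) → u l ≢ v l → BoundedBelow u v
    facet-bounded-below {v} {u} {l} v∈cube (inj₁ ul≡0) ul≢vl x t x∈K x≈ =
      0<∧0≤p*q⇒0≤q 0<vl (subst (0ℚ ≤_) xl≡ (proj₁ (proj₁ x∈K l)))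
      where
      0<vl : 0ℚ < v l
      0<vl = ≤∧≢⇒< (proj₁ (v∈cube l)) (λ 0≡vl → ul≢vl (trans ul≡0 0≡vl))
      lemma : ∀ t q → (1ℚ - t) * 0ℚ + t * q ≡ q * t
      lemma = solve-∀ ℚ-ring
      xl≡ : x l ≡ v l * t
      xl≡ = trans (x≈ l) (trans (cong (λ z → (1ℚ - t) * z + t * v l) ul≡0) (lemma t (v l)))
    facet-bounded-below {v} {u} {l} v∈cube (inj₂ ul≡1) ul≢vl x t x∈K x≈ =
      0<∧0≤p*q⇒0≤q 0<1-vl (subst (0ℚ ≤_) 1-xl≡ (p≤q⇒0≤q-p (proj₂ (proj₁ x∈K l))))
      where
      0<1-vl : 0ℚ < 1ℚ - v l
      0<1-vl = p<q⇒0<q-p (≤∧≢⇒< (proj₂ (v∈cube l)) (λ vl≡1 → ul≢vl (trans ul≡1 (sym vl≡1))))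
      lemma : ∀ t q → 1ℚ - ((1ℚ - t) * 1ℚ + t * q) ≡ (1ℚ - q) * t
      lemma = solve-∀ ℚ-ring
      1-xl≡ : 1ℚ - x l ≡ (1ℚ - v l) * t
      1-xl≡ = trans (cong (λ z → 1ℚ - z) (trans (x≈ l) (cong (λ z → (1ℚ - t) * z + t * v l) ul≡1))) (lemma t (v l))

    tight-bounded-below : a · u ≡ ρ → a · v < ρ → BoundedBelow u v
    tight-bounded-below {u} {v} a·u≡ρ a·v<ρ x t x∈K x≈ =
      0<∧0≤p*q⇒0≤q (p<q⇒0<q-p a·v<ρ) (subst (0ℚ ≤_) ρ-a·x≡ (p≤q⇒0≤q-p (proj₂ x∈K)))
      where
      lemma : ∀ t p r → r - ((1ℚ - t) * r + t * p) ≡ (r - p) * t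
      lemma = solve-∀ ℚ-ring
      ρ-a·x≡ : ρ - a · x ≡ (ρ - a · v) * t
      ρ-a·x≡ = trans (cong (λ z → ρ - z) (trans (·-cong a x≈)
                       (trans (·-seg a t u v) (cong (λ z → (1ℚ - t) * z + t * (a · v)) a·u≡ρ))))
                     (lemma t (a · v) ρ)

    bounded-above : BoundedBelow v u → ∀ {x t} → InCut x → x ≈ seg t u v → t ≤ 1ℚ
    bounded-above {v} {u} below {x} {t} x∈K x≈ =
      0≤q-p⇒p≤q (below x (1ℚ - t) x∈K (λ l → trans (x≈ l) (lemma t (u l) (v l))))
      where lemma : ∀ t p q → (1ℚ - t) * p + t * q ≡ (1ℚ - (1ℚ - t)) * q + (1ℚ - t) * p
            lemma = solve-∀ ℚ-ring

    tight-face-coordinate : ∀ {R i j t} → a i ≢ 0ℚ → OnFace R i j u → OnFace R i j v → OnFace R i j x →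
      a · u ≡ ρ → a · v ≡ ρ → a · x ≡ ρ → x j ≡ seg t u v j → x i ≡ seg t u v i
    tight-face-coordinate {u} {v} {x} {R} {i} {j} {t} aᵢ≢0 onFaceᵤ onFaceᵥ onFaceₓ a·u≡ρ a·v≡ρ a·x≡ρ xj≡ =
      p-q≡0⇒p≡q (p*q≡0⇒q≡0 aᵢ≢0 (trans (sym (·-single a off)) a·gap≡0))
      where
      gap : Pt _
      gap l = x l - seg t u v l
      off : ∀ l → l ≢ i → gap l ≡ 0ℚ
      off l l≢i with l ≟ᶠ j
      ... | yes refl = trans (cong (_- seg t u v l) xj≡) (+-inverseʳ (seg t u v l))
      ... | no l≢j = trans (cong (_- seg t u v l) (onFace-segment-off {R = R} {t = t} onFaceᵤ onFaceᵥ onFaceₓ l≢i l≢j))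
                           (+-inverseʳ (seg t u v l))
      lemma : ∀ t r → r - ((1ℚ - t) * r + t * r) ≡ 0ℚ
      lemma = solve-∀ ℚ-ring
      a·gap≡0 : a · gap ≡ 0ℚ
      a·gap≡0 = begin
        a · gap                                       ≡⟨ ·-diff a x (seg t u v) ⟩
        a · x - a · seg t u v                       ≡⟨ cong₂ _-_ a·x≡ρ (·-seg a t u v) ⟩
        ρ - ((1ℚ - t) * (a · u) + t * (a · v))      ≡⟨ cong₂ (λ p q → ρ - ((1ℚ - t) * p + t * q)) a·u≡ρ a·v≡ρ ⟩
        ρ - ((1ℚ - t) * ρ + t * ρ)                  ≡⟨ lemma t ρ ⟩
        0ℚ                                          ∎
        where open ≡-Reasoning

    edge-on-line : ∀ {R k} → InCut u → InCut v → OnFace R k k u → OnFace R k k v → u k ≢ v k →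
                   BoundedBelow u v → BoundedBelow v u → IsEdge InCut u v
    edge-on-line {u} {v} {R} {k} u∈K v∈K onFaceᵤ onFaceᵥ uk≢vk below above =
      edge-of-face {R = R} u∈K v∈K (λ u≈v → uk≢vk (u≈v k)) onFaceᵤ onFaceᵥ on-segment
      where
      on-segment : ∀ x → InCut x → OnFace R k k x → OnSegment u v x
      on-segment x x∈K onFaceₓ = t , below x t x∈K x≈ , bounded-above above x∈K x≈ , x≈
        where
        t = proj₁ (segment-parameter {u = u} {v} {k} uk≢vk (x k))
        x≈ = onFace-segment {R = R} {t = t} onFaceᵤ onFaceᵥ onFaceₓ
               (proj₂ (segment-parameter {u = u} {v} {k} uk≢vk (x k)))
               (proj₂ (segment-parameter {u = u} {v} {k} uk≢vk (x k)))

    edge-on-tight-face : ∀ {R i j} → a i ≢ 0ℚ → InCut u → InCut v → OnFace R i j u → OnFace R i j v →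
      a · u ≡ ρ → a · v ≡ ρ → u j ≢ v j → BoundedBelow u v → BoundedBelow v u → IsEdge InCut u v
    edge-on-tight-face {u} {v} {R} {i} {j} aᵢ≢0 u∈K v∈K onFaceᵤ onFaceᵥ a·u≡ρ a·v≡ρ uj≢vj below above =
      edge-of-tight-face {R = R} u∈K v∈K (λ u≈v → uj≢vj (u≈v j)) onFaceᵤ onFaceᵥ a·u≡ρ a·v≡ρ on-segment
      where
      on-segment : ∀ x → InCut x → OnFace R i j x → a · x ≡ ρ → OnSegment u v x
      on-segment x x∈K onFaceₓ a·x≡ρ = t , below x t x∈K x≈ , bounded-above above x∈K x≈ , x≈
        where
        t = proj₁ (segment-parameter {u = u} {v} {j} uj≢vj (x j))
        xj≡ = proj₂ (segment-parameter {u = u} {v} {j} uj≢vj (x j))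
        x≈ = onFace-segment {R = R} {t = t} onFaceᵤ onFaceᵥ onFaceₓ
               (tight-face-coordinate {R = R} {t = t} aᵢ≢0 onFaceᵤ onFaceᵥ onFaceₓ a·u≡ρ a·v≡ρ a·x≡ρ xj≡) xj≡

    cube-edge : InCut u → InCut v → u ≈ eS S → v ≈ eS T → DifferOnlyAt k S T → IsEdge InCut u v
    cube-edge {u} {v} {S} {T} {k} u∈K v∈K u≈ v≈ (differ , agree) =
      edge-on-line {R = S} u∈K v∈K (λ l _ _ → u≈ l) onFaceᵥ uk≢vk
        (facet-bounded-below (proj₁ v∈K) (subst ZeroOrOne (sym (u≈ k)) (eS-zeroOrOne S k)) uk≢vk)
        (facet-bounded-below (proj₁ u∈K) (subst ZeroOrOne (sym (v≈ k)) (eS-zeroOrOne T k)) (≢-sym uk≢vk))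
      where
      onFaceᵥ : OnFace S k k v
      onFaceᵥ l l≢k _ = trans (v≈ l) (eS-cong {S = T} {l} {S} (sym (agree l l≢k l≢k)))
      uk≢vk : u k ≢ v k
      uk≢vk eq = eS-≢ {S = S} {k} {T} differ (trans (sym (u≈ k)) (trans eq (v≈ k)))

    module AvoidingVertices (avoids : ∀ S → a · eS S ≢ ρ) where

      set-point-slack : InCut u → u ≈ eS S → a · u < ρ
      set-point-slack {u} {S} (_ , a·u≤ρ) u≈ =
        ≤∧≢⇒< a·u≤ρ (λ a·u≡ρ → avoids S (trans (sym (·-cong a u≈)) a·u≡ρ))

      cut-weight≢0 : CutPoint S k v → a k ≢ 0ℚ
      cut-weight≢0 {S} {k} (_ , t , t*aₖ≡ , _) aₖ≡0 = avoids S (sym (p-q≡0⇒p≡q (begin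
        ρ - a · eS S  ≡⟨ sym t*aₖ≡ ⟩
        t * a k       ≡⟨ cong (t *_) aₖ≡0 ⟩
        t * 0ℚ        ≡⟨ *-zeroʳ t ⟩
        0ℚ            ∎)))
        where open ≡-Reasoning

      -- A parameter 0 or 1 would put the cube vertex e_S or e_(S ∪ {k}) on the hyperplane.
      cut-frac : InCube v → CutPoint S k v → Frac (v k)
      cut-frac {v} {S} {k} v∈cube cut@(k∉S , t , _ , v≈) with frac? (v k)
      ... | yes frac = frac
      ... | no ¬frac with ¬frac⇒zeroOrOne (proj₁ (v∈cube k)) (proj₂ (v∈cube k)) ¬frac
      ...   | inj₁ vk≡0 = ⊥-elim (avoids S (trans (·-cong a at0) (cut-tight cut)))
        where t≡0 = trans (sym (cut-coordinate cut)) vk≡0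
              at0 : ∀ l → eS S l ≡ v l
              at0 l = sym (trans (v≈ l) (trans (cong (λ z → eS S l + z * e k l) t≡0)
                                              (trans (cong (eS S l +_) (*-zeroˡ (e k l))) (+-identityʳ _))))
      ...   | inj₂ vk≡1 = ⊥-elim (avoids (S ∪ ⁅ k ⁆) (trans (·-cong a at1) (cut-tight cut)))
        where t≡1 = trans (sym (cut-coordinate cut)) vk≡1
              at1 : ∀ l → eS (S ∪ ⁅ k ⁆) l ≡ v l
              at1 l = trans (eS-∪⁅⁆≡+e k∉S l) (sym (trans (v≈ l)
                (trans (cong (λ z → eS S l + z * e k l) t≡1) (cong (eS S l +_) (*-identityˡ (e k l))))))

      cut-unique : CutPoint S k u → CutPoint S k v → u ≈ v
      cut-unique {S} {k} {u} {v} cutᵤ@(_ , t , t*aₖ≡ , u≈) (_ , t′ , t′*aₖ≡ , v≈) l =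
        trans (u≈ l) (trans (cong (λ z → eS S l + z * e k l) t≡t′) (sym (v≈ l)))
        where t≡t′ = *-cancelʳ-≢0 {p = t} {t′} (cut-weight≢0 cutᵤ) (trans t*aₖ≡ (sym t′*aₖ≡))

      set-set-edge⇒differOnlyAt : IsEdge InCut u v → u ≈ eS S → v ≈ eS T → Σ (Fin n) λ k → DifferOnlyAt k S T
      set-set-edge⇒differOnlyAt {u} {v} {S} {T} edge@(u∈K , v∈K , u≉v , _) u≈ v≈ = k₀ , differ , agree
        where
        difference = ¬∀⟶∃¬ _ (λ l → lookup S l ≡ lookup T l) (λ l → lookup S l ≟ᵇ lookup T l)
          (λ same → u≉v (λ l → trans (u≈ l) (trans (eS-cong {S = S} {l} {T} (same l)) (sym (v≈ l)))))
        k₀ = proj₁ difference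
        differ = proj₂ difference
        slack = mid-slack (set-point-slack {S = S} u∈K u≈) (proj₂ v∈K)
        agree : AgreeOff k₀ k₀ S T
        agree l l≢k₀ _ = mid-integral⇒agree {u = u} {v} {l} {S} {T} (u≈ l) (v≈ l) λ fracₗ →
          l≢k₀ (edge-mid-frac-unique edge slack (mid-frac-differ {u = u} {v} {k₀} {S} {T} (u≈ k₀) (v≈ k₀) differ) fracₗ)

      set-cut-edge⇒agreeOff : IsEdge InCut u v → u ≈ eS S → CutPoint T k v → AgreeOff k k S T
      set-cut-edge⇒agreeOff {u} {v} {S} {T} {k} edge@(u∈K , v∈K , _) u≈ cut l l≢k _ =
        mid-integral⇒agree {u = u} {v} {l} {S} {T} (u≈ l) (cut-off cut l≢k)
          λ fracₗ → l≢k (edge-mid-frac-unique edge slack fracₖ fracₗ)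
        where
        slack = mid-slack (set-point-slack {S = S} u∈K u≈) (proj₂ v∈K)
        fracₖ = mid-frac-right {u = u} {v = v} (proj₁ (proj₁ u∈K k)) (proj₂ (proj₁ u∈K k)) (cut-frac (proj₁ v∈K) cut)

      cut-cut-edge⇒agreeOff : i ≢ j → IsEdge InCut u v → CutPoint S i u → CutPoint T j v → AgreeOff i j S T
      cut-cut-edge⇒agreeOff {i} {j} {u} {v} {S} {T} i≢j edge@(u∈K , v∈K , _) cutᵤ cutᵥ l l≢i l≢j =
        mid-integral⇒agree {u = u} {v} {l} {S} {T} (cut-off cutᵤ l≢i) (cut-off cutᵥ l≢j) λ fracₗ →
          [ l≢i , l≢j ]′ (edge-mid-frac-pair edge i≢j fracᵢ fracⱼ fracₗ)
        where
        fracᵢ = mid-frac-left {u = u} {v = v} (proj₁ (proj₁ v∈K i)) (proj₂ (proj₁ v∈K i)) (cut-frac (proj₁ u∈K) cutᵤ)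
        fracⱼ = mid-frac-right {u = u} {v = v} (proj₁ (proj₁ u∈K j)) (proj₂ (proj₁ u∈K j)) (cut-frac (proj₁ v∈K) cutᵥ)

      cut-cut-same-edge⇒agreeOff : IsEdge InCut u v → CutPoint S i u → CutPoint T i v →
                          Σ (Fin n) λ l → (l ≢ i) × (lookup S l ≢ lookup T l) × AgreeOff i l S T
      cut-cut-same-edge⇒agreeOff {u} {v} {S} {i} {T} edge@(u∈K , v∈K , u≉v , _) cutᵤ cutᵥ = l₀ , l₀≢i , differ , agree
        where
        same-set⇒same-point : S ≡ T → u ≈ v
        same-set⇒same-point refl = cut-unique cutᵤ cutᵥ
        difference = ¬∀⟶∃¬ _ (λ l → lookup S l ≡ lookup T l) (λ l → lookup S l ≟ᵇ lookup T l)
          (λ same → u≉v (same-set⇒same-point (subset-ext same)))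
        l₀ = proj₁ difference
        differ = proj₂ difference
        l₀≢i : l₀ ≢ i
        l₀≢i l₀≡i = differ (subst (λ l → lookup S l ≡ lookup T l) (sym l₀≡i)
          (trans (∉⇒lookup≡false (proj₁ cutᵤ)) (sym (∉⇒lookup≡false (proj₁ cutᵥ)))))
        fracᵢ = mid-frac-left {u = u} {v} (proj₁ (proj₁ v∈K i)) (proj₂ (proj₁ v∈K i)) (cut-frac (proj₁ u∈K) cutᵤ)
        fracₗ₀ = mid-frac-differ {u = u} {v} {l₀} {S} {T} (cut-off cutᵤ l₀≢i) (cut-off cutᵥ l₀≢i) differ
        agree : AgreeOff i l₀ S T
        agree l l≢i l≢l₀ = mid-integral⇒agree {u = u} {v} {l} {S} {T} (cut-off cutᵤ l≢i) (cut-off cutᵥ l≢i)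
          λ fracₗ → [ l≢i , l≢l₀ ]′ (edge-mid-frac-pair edge (≢-sym l₀≢i) fracᵢ fracₗ₀ fracₗ)

      cut-bounded-below : InCube v → CutPoint T k v → ZeroOrOne (u k) → BoundedBelow u v
      cut-bounded-below v∈cube cut uk∈01 =
        facet-bounded-below v∈cube uk∈01 (zeroOrOne-≢-frac uk∈01 (cut-frac v∈cube cut))

      truncated-cube-edge : ∀ {R} → InCut u → InCut v → a · u < ρ → OnFace R k k u → ZeroOrOne (u k) →
                            CutPoint R k v → IsEdge InCut u v
      truncated-cube-edge {u} {v} {k} {R} u∈K v∈K a·u<ρ onFaceᵤ uk∈01 cut =
        edge-on-line {R = R} u∈K v∈K onFaceᵤ (λ l l≢k _ → cut-off cut l≢k) uk≢vk
          (facet-bounded-below (proj₁ v∈K) uk∈01 uk≢vk)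
          (tight-bounded-below (cut-tight cut) a·u<ρ)
        where uk≢vk = zeroOrOne-≢-frac uk∈01 (cut-frac (proj₁ v∈K) cut)

  -- Half-integrality of w · e_S
  half : ℤ → ℚ
  half z = fromℚᵘ (mkℚᵘ z 1)

  fromℚᵘ-+ : ∀ p q → fromℚᵘ (p ℚᵘ.+ q) ≡ fromℚᵘ p + fromℚᵘ q
  fromℚᵘ-+ p q = toℚᵘ-injective (ℚᵘₚ.≃-trans (toℚᵘ-fromℚᵘ (p ℚᵘ.+ q))
    (ℚᵘₚ.≃-sym (ℚᵘₚ.≃-trans (toℚᵘ-homo-+ (fromℚᵘ p) (fromℚᵘ q))
                             (ℚᵘₚ.+-cong (toℚᵘ-fromℚᵘ p) (toℚᵘ-fromℚᵘ q)))))

  half-+ : ∀ z z′ → half z + half z′ ≡ half (z ℤ.+ z′)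
  half-+ z z′ = trans (sym (fromℚᵘ-+ (mkℚᵘ z 1) (mkℚᵘ z′ 1)))
    (fromℚᵘ-cong {mkℚᵘ z 1 ℚᵘ.+ mkℚᵘ z′ 1} {mkℚᵘ (z ℤ.+ z′) 1} (*≡* (lemma z z′)))
    where lemma : ∀ z z′ → (z ℤ.* ℤ.+ 2 ℤ.+ z′ ℤ.* ℤ.+ 2) ℤ.* ℤ.+ 2 ≡ (z ℤ.+ z′) ℤ.* ℤ.+ 4
          lemma = ℤ-Solver.solve-∀

  HalfIntegral : ℚ → Set
  HalfIntegral p = Σ ℤ λ z → p ≡ half z

  halfIntegral-+ : HalfIntegral p → HalfIntegral q → HalfIntegral (p + q)
  halfIntegral-+ (z , refl) (z′ , refl) = z ℤ.+ z′ , half-+ z z′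

  halfIntegral-sum : (f : Fin n → ℚ) → (∀ i → HalfIntegral (f i)) → HalfIntegral (sumℚ f)
  halfIntegral-sum {zero} f _ = ℤ.+ 0 , refl
  halfIntegral-sum {suc n} f half-f =
    halfIntegral-+ (half-f zero) (halfIntegral-sum (λ i → f (suc i)) (λ i → half-f (suc i)))

  halfIntegral-·-eS : ∀ (c : Pt n) S → (∀ i → HalfIntegral (c i)) → HalfIntegral (c · eS S)
  halfIntegral-·-eS c S half-c = halfIntegral-sum (λ l → c l * eS S l) term
    where
    term : ∀ l → HalfIntegral (c l * eS S l)
    term l with lookup S l
    ... | true = subst HalfIntegral (sym (*-identityʳ (c l))) (half-c l)
    ... | false = ℤ.+ 0 , *-zeroʳ (c l)

  -- Clearing denominators, z/2 = B/2 + 1/4 would say 2z = 2B + 1.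
  half≢rhs : ∀ d (b : Fin d → ℕ) z → half z ≢ rhs d b
  half≢rhs d b z eq = even≢odd z (sumℕ b)
    (ℤₚ.*-cancelʳ-≡ (z ℤ.* ℤ.+ 2) (ℤ.+ sumℕ b ℤ.* ℤ.+ 2 ℤ.+ ℤ.+ 1) (ℤ.+ 4)
      (trans (lemma₁ z) (trans 8z≡ (lemma₂ (ℤ.+ sumℕ b)))))
    where
    lemma₁ : ∀ z → z ℤ.* ℤ.+ 2 ℤ.* ℤ.+ 4 ≡ z ℤ.* ℤ.+ 8
    lemma₁ = ℤ-Solver.solve-∀
    lemma₂ : ∀ B → (B ℤ.* ℤ.+ 4 ℤ.+ ℤ.+ 1 ℤ.* ℤ.+ 2) ℤ.* ℤ.+ 2 ≡ (B ℤ.* ℤ.+ 2 ℤ.+ ℤ.+ 1) ℤ.* ℤ.+ 4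
    lemma₂ = ℤ-Solver.solve-∀
    8z≡ : z ℤ.* ℤ.+ 8 ≡ (ℤ.+ sumℕ b ℤ.* ℤ.+ 4 ℤ.+ ℤ.+ 1 ℤ.* ℤ.+ 2) ℤ.* ℤ.+ 2
    8z≡ with fromℚᵘ-injective {mkℚᵘ z 1} {mkℚᵘ (ℤ.+ sumℕ b) 1 ℚᵘ.+ mkℚᵘ (ℤ.+ 1) 3}
               (trans eq (sym (fromℚᵘ-+ (mkℚᵘ (ℤ.+ sumℕ b) 1) (mkℚᵘ (ℤ.+ 1) 3))))
    ... | *≡* eq′ = eq′
    even≢odd : ∀ z m → z ℤ.* ℤ.+ 2 ≢ ℤ.+ m ℤ.* ℤ.+ 2 ℤ.+ ℤ.+ 1
    even≢odd (ℤ.+ k) m eq = ℕₚ.even≢odd k m (begin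
      2 ℕ.* k           ≡⟨ ℕₚ.*-comm 2 k ⟩
      k ℕ.* 2           ≡⟨ ℤₚ.+-injective (trans (ℤₚ.pos-* k 2) (trans eq (cong (ℤ._+ ℤ.+ 1) (sym (ℤₚ.pos-* m 2))))) ⟩
      m ℕ.* 2 ℕ.+ 1     ≡⟨ ℕₚ.+-comm (m ℕ.* 2) 1 ⟩
      suc (m ℕ.* 2)     ≡⟨ cong suc (ℕₚ.*-comm m 2) ⟩
      suc (2 ℕ.* m)     ∎)
      where open ≡-Reasoning
    even≢odd -[1+ k ] m eq with trans eq (cong (ℤ._+ ℤ.+ 1) (sym (ℤₚ.pos-* m 2)))
    ... | ()

  w-halfIntegral : ∀ d (b : Fin d → ℕ) l → HalfIntegral (w d b l)
  w-halfIntegral d b l with splitAt d l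
  ... | inj₁ j = ℤ.+ b j ℤ.* ℤ.+ 2 ,
    fromℚᵘ-cong {mkℚᵘ (ℤ.+ b j) 0} {mkℚᵘ (ℤ.+ b j ℤ.* ℤ.+ 2) 1} (*≡* (lemma (ℤ.+ b j)))
    where lemma : ∀ z → z ℤ.* ℤ.+ 2 ≡ (z ℤ.* ℤ.+ 2) ℤ.* ℤ.+ 1
          lemma = ℤ-Solver.solve-∀
  ... | inj₂ zero = ℤ.- (ℤ.+ sumℕ b) , neg-half (sumℕ b)
    where neg-half : ∀ m → - half (ℤ.+ m) ≡ half (ℤ.- (ℤ.+ m))
          neg-half zero = refl
          neg-half (suc m) = refl
  ... | inj₂ (suc zero) = ℤ.+ sumℕ b ℤ.+ ℤ.+ 1 , half-+ (ℤ.+ sumℕ b) (ℤ.+ 1)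

  w·eS≢rhs : ∀ d (b : Fin d → ℕ) S → w d b · eS S ≢ rhs d b
  w·eS≢rhs d b S eq with halfIntegral-·-eS (w d b) S (w-halfIntegral d b)
  ... | z , w·eS≡half = half≢rhs d b z (trans (sym w·eS≡half) eq)

  pattern case-a x = inj₁ x
  pattern case-b x = inj₂ (inj₁ x)
  pattern case-c x = inj₂ (inj₂ (inj₁ x))
  pattern case-d x = inj₂ (inj₂ (inj₂ (inj₁ x)))
  pattern case-e x = inj₂ (inj₂ (inj₂ (inj₂ (inj₁ x))))
  pattern case-f x = inj₂ (inj₂ (inj₂ (inj₂ (inj₂ x))))

  -- For a = w d b and ρ = rhs d b, InCut, IsEdge and CutPoint unfold to InP, Adjacent and IsCutPt.
  module _ (d : ℕ) (b : Fin d → ℕ) where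
    open HalfspaceCut (w d b) (rhs d b)
    open AvoidingVertices (w·eS≢rhs d b)

    case-c⇒adjacent : InP d b u → InP d b v → i ≢ j → j ∉ S → CutPoint S i u → CutPoint S j v →
                      Adjacent d b u v
    case-c⇒adjacent {u} {v} {i} {j} {S} u∈P v∈P i≢j j∉S cutᵤ cutᵥ =
      edge-on-tight-face {R = S} (cut-weight≢0 cutᵤ) u∈P v∈P
        (λ l l≢i _ → cut-off cutᵤ l≢i) (λ l _ l≢j → cut-off cutᵥ l≢j) (cut-tight cutᵤ) (cut-tight cutᵥ)
        (zeroOrOne-≢-frac (inj₁ uj≡0) (cut-frac (proj₁ v∈P) cutᵥ))
        (cut-bounded-below (proj₁ v∈P) cutᵥ (inj₁ uj≡0)) (cut-bounded-below (proj₁ u∈P) cutᵤ (inj₁ vi≡0))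
      where
      uj≡0 = trans (cut-off cutᵤ (≢-sym i≢j)) (∉⇒eS≡0 j∉S)
      vi≡0 = trans (cut-off cutᵥ i≢j) (∉⇒eS≡0 (proj₁ cutᵤ))

    case-d⇒adjacent : InP d b u → InP d b v → i ≢ j → j ∉ S → CutPoint S i u → CutPoint (S ∪ ⁅ i ⁆) j v →
                      Adjacent d b u v
    case-d⇒adjacent {u} {v} {i} {j} {S} u∈P v∈P i≢j j∉S cutᵤ cutᵥ =
      edge-on-tight-face {R = S} (cut-weight≢0 cutᵤ) u∈P v∈P
        (λ l l≢i _ → cut-off cutᵤ l≢i) (λ l l≢i l≢j → trans (cut-off cutᵥ l≢j) (eS-∪⁅⁆-≢ S l≢i))
        (cut-tight cutᵤ) (cut-tight cutᵥ)
        (zeroOrOne-≢-frac (inj₁ uj≡0) (cut-frac (proj₁ v∈P) cutᵥ))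
        (cut-bounded-below (proj₁ v∈P) cutᵥ (inj₁ uj≡0)) (cut-bounded-below (proj₁ u∈P) cutᵤ (inj₂ vi≡1))
      where
      uj≡0 = trans (cut-off cutᵤ (≢-sym i≢j)) (∉⇒eS≡0 j∉S)
      vi≡1 = trans (cut-off cutᵥ i≢j) (eS-∪⁅⁆-same S i)

    case-e⇒adjacent : InP d b u → InP d b v → i ≢ j → j ∉ S → CutPoint S i u → CutPoint (S ∪ ⁅ j ⁆) i v →
                      Adjacent d b u v
    case-e⇒adjacent {u} {v} {i} {j} {S} u∈P v∈P i≢j j∉S cutᵤ cutᵥ =
      edge-on-tight-face {R = S} (cut-weight≢0 cutᵤ) u∈P v∈P
        (λ l l≢i _ → cut-off cutᵤ l≢i) (λ l l≢i l≢j → trans (cut-off cutᵥ l≢i) (eS-∪⁅⁆-≢ S l≢j))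
        (cut-tight cutᵤ) (cut-tight cutᵥ) uj≢vj
        (facet-bounded-below (proj₁ v∈P) (inj₁ uj≡0) uj≢vj)
        (facet-bounded-below (proj₁ u∈P) (inj₂ vj≡1) (≢-sym uj≢vj))
      where
      uj≡0 = trans (cut-off cutᵤ (≢-sym i≢j)) (∉⇒eS≡0 j∉S)
      vj≡1 = trans (cut-off cutᵥ (≢-sym i≢j)) (eS-∪⁅⁆-same S j)
      uj≢vj : u j ≢ v j
      uj≢vj uj≡vj = 1≢0 (trans (sym vj≡1) (trans (sym uj≡vj) uj≡0))

    case-f⇒adjacent : InP d b u → InP d b v → i ≢ j → CutPoint (S ∪ ⁅ i ⁆) j u → CutPoint (S ∪ ⁅ j ⁆) i v →
                      Adjacent d b u v
    case-f⇒adjacent {u} {v} {i} {j} {S} u∈P v∈P i≢j cutᵤ cutᵥ =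
      edge-on-tight-face {R = S} (cut-weight≢0 cutᵥ) u∈P v∈P
        (λ l l≢i l≢j → trans (cut-off cutᵤ l≢j) (eS-∪⁅⁆-≢ S l≢i))
        (λ l l≢i l≢j → trans (cut-off cutᵥ l≢i) (eS-∪⁅⁆-≢ S l≢j))
        (cut-tight cutᵤ) (cut-tight cutᵥ)
        (≢-sym (zeroOrOne-≢-frac (inj₂ vj≡1) (cut-frac (proj₁ u∈P) cutᵤ)))
        (cut-bounded-below (proj₁ v∈P) cutᵥ (inj₂ ui≡1)) (cut-bounded-below (proj₁ u∈P) cutᵤ (inj₂ vj≡1))
      where
      ui≡1 = trans (cut-off cutᵤ i≢j) (eS-∪⁅⁆-same S i)
      vj≡1 = trans (cut-off cutᵥ (≢-sym i≢j)) (eS-∪⁅⁆-same S j)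

    set-set⇒case-a : Adjacent d b u v → u ≈ eS S → v ≈ eS T → Cases d b u v
    set-set⇒case-a {u} {v} {S} {T} edge u≈ v≈ =
      case-a (S , T , u≈ , v≈ ,
              trans (cong ∣_∣ˢ (differOnlyAt⇒symdiff≡⁅⁆ {S = S} {T} (proj₂ differ))) (∣⁅x⁆∣≡1 (proj₁ differ)))
      where differ = set-set-edge⇒differOnlyAt {S = S} {T} edge u≈ v≈
    set-cut⇒case-b : Adjacent d b u v → u ≈ eS S → CutPoint T k v → Cases d b u v
    set-cut⇒case-b {u} {v} {S} {T} {k} edge u≈ cut = case-b (S , u≈ , by-membership (lookup S k) refl)
      where
      agree = set-cut-edge⇒agreeOff {S = S} edge u≈ cut
      Tk≡false = ∉⇒lookup≡false (proj₁ cut)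
      by-membership : ∀ x → lookup S k ≡ x → (Σ (Fin _) λ i → (i ∉ S) × CutPoint S i v)
                                            ⊎ (Σ (Fin _) λ j → (j ∈ S) × CutPoint (S ─ ⁅ j ⁆) j v)
      by-membership false Sk≡false = inj₁ (k , lookup≡false⇒∉ Sk≡false , subst (λ R → CutPoint R k v) (sym S≡T) cut)
        where S≡T = agreeOff-ext (trans Sk≡false (sym Tk≡false)) (trans Sk≡false (sym Tk≡false)) agree
      by-membership true Sk≡true = inj₂ (k , lookup⇒[]= k S Sk≡true , subst (λ R → CutPoint R k v) (sym S─k≡T) cut)
        where S─k≡T = agreeOff-ext (trans (lookup-─⁅⁆ S k) (sym Tk≡false)) (trans (lookup-─⁅⁆ S k) (sym Tk≡false))
                                   (λ l l≢k _ → trans (lookup-─⁅⁆-≢ S l≢k) (agree l l≢k l≢k))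

    cut-cut-same⇒case-e : Adjacent d b u v → CutPoint S i u → CutPoint T i v → Cases d b u v ⊎ Cases d b v u
    cut-cut-same⇒case-e {u} {v} {S} {i} {T} edge cutᵤ cutᵥ = by-membership (lookup S l₀) refl
      where
      found = cut-cut-same-edge⇒agreeOff {S = S} {T = T} edge cutᵤ cutᵥ
      l₀ = proj₁ found
      l₀≢i = proj₁ (proj₂ found)
      differ = proj₁ (proj₂ (proj₂ found))
      agree = proj₂ (proj₂ (proj₂ found))
      Si≡false = ∉⇒lookup≡false (proj₁ cutᵤ)
      Ti≡false = ∉⇒lookup≡false (proj₁ cutᵥ)
      by-membership : ∀ x → lookup S l₀ ≡ x → Cases d b u v ⊎ Cases d b v u
      by-membership false Sl≡false = inj₁ (case-e (S , i , l₀ , ≢-sym l₀≢i , proj₁ cutᵤ , lookup≡false⇒∉ Sl≡false ,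
                                                  cutᵤ , subst (λ R → CutPoint R i v) T≡S∪l₀ cutᵥ))
        where
        Tl≡true = trans (¬-not (≢-sym differ)) (cong not Sl≡false)
        T≡S∪l₀ = agreeOff⇒≡∪⁅⁆ agree (trans Si≡false (sym Ti≡false)) Sl≡false Tl≡true
      by-membership true Sl≡true = inj₂ (case-e (T , i , l₀ , ≢-sym l₀≢i , proj₁ cutᵥ , lookup≡false⇒∉ Tl≡false ,
                                                cutᵥ , subst (λ R → CutPoint R i u) S≡T∪l₀ cutᵤ))
        where
        Tl≡false = trans (¬-not (≢-sym differ)) (cong not Sl≡true)
        S≡T∪l₀ = agreeOff⇒≡∪⁅⁆ (agreeOff-sym {S = S} {T} agree) (trans Ti≡false (sym Si≡false)) Tl≡false Sl≡true

    cut-cut⇒cases : i ≢ j → Adjacent d b u v → CutPoint S i u → CutPoint T j v → Cases d b u v ⊎ Cases d b v u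
    cut-cut⇒cases {i} {j} {u} {v} {S} {T} i≢j edge cutᵤ cutᵥ = by-membership (lookup S j) (lookup T i) refl refl
      where
      agree = cut-cut-edge⇒agreeOff {S = S} {T = T} i≢j edge cutᵤ cutᵥ
      Si≡false = ∉⇒lookup≡false (proj₁ cutᵤ)
      Tj≡false = ∉⇒lookup≡false (proj₁ cutᵥ)
      by-membership : ∀ x y → lookup S j ≡ x → lookup T i ≡ y → Cases d b u v ⊎ Cases d b v u
      by-membership false false Sj≡ Ti≡ =
        inj₁ (case-c (S , i , j , i≢j , proj₁ cutᵤ , lookup≡false⇒∉ Sj≡ ,
                      cutᵤ , subst (λ R → CutPoint R j v) (sym S≡T) cutᵥ))
        where S≡T = agreeOff-ext (trans Si≡false (sym Ti≡)) (trans Sj≡ (sym Tj≡false)) agree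
      by-membership false true Sj≡ Ti≡ =
        inj₁ (case-d (S , i , j , i≢j , proj₁ cutᵤ , lookup≡false⇒∉ Sj≡ ,
                      cutᵤ , subst (λ R → CutPoint R j v) T≡S∪i cutᵥ))
        where T≡S∪i = agreeOff⇒≡∪⁅⁆ (agreeOff-swap {S = S} {T} agree) (trans Sj≡ (sym Tj≡false)) Si≡false Ti≡
      by-membership true false Sj≡ Ti≡ =
        inj₂ (case-d (T , j , i , ≢-sym i≢j , proj₁ cutᵥ , lookup≡false⇒∉ Ti≡ ,
                      cutᵥ , subst (λ R → CutPoint R i u) S≡T∪j cutᵤ))
        where S≡T∪j = agreeOff⇒≡∪⁅⁆ (agreeOff-sym {S = S} {T} agree) (trans Ti≡ (sym Si≡false)) Tj≡false Sj≡
      by-membership true true Sj≡ Ti≡ =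
        inj₁ (case-f (R , j , i , ≢-sym i≢j , j∉R , i∉R ,
                      subst (λ X → CutPoint X i u) S≡R∪j cutᵤ , subst (λ X → CutPoint X j v) T≡R∪i cutᵥ))
        where
        R = S ─ ⁅ j ⁆
        Ri≡false = trans (lookup-─⁅⁆-≢ S i≢j) Si≡false
        j∉R = lookup≡false⇒∉ (lookup-─⁅⁆ S j)
        i∉R = lookup≡false⇒∉ Ri≡false
        S≡R∪j : S ≡ R ∪ ⁅ j ⁆
        S≡R∪j = agreeOff-ext {i = j} {j} (trans Sj≡ (sym (lookup-∪⁅⁆ R j))) (trans Sj≡ (sym (lookup-∪⁅⁆ R j)))
          (λ l l≢j _ → sym (trans (lookup-∪⁅⁆-≢ R l≢j) (lookup-─⁅⁆-≢ S l≢j)))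
        R-agree : AgreeOff j i R T
        R-agree l l≢j l≢i = trans (lookup-─⁅⁆-≢ S l≢j) (agree l l≢i l≢j)
        T≡R∪i = agreeOff⇒≡∪⁅⁆ R-agree (trans (lookup-─⁅⁆ S j) (sym Tj≡false)) Ri≡false Ti≡

    forward : IsVertex d b u → IsVertex d b v → Adjacent d b u v → Cases d b u v ⊎ Cases d b v u
    forward {u} {v} (u∈P , cᵤ , exposesᵤ) (v∈P , cᵥ , exposesᵥ) edge =
      by-form (vertex-form {c = cᵤ} u∈P exposesᵤ) (vertex-form {c = cᵥ} v∈P exposesᵥ)
      where
      by-coordinate : ∀ {i j S T} → Dec (i ≡ j) → CutPoint S i u → CutPoint T j v → Cases d b u v ⊎ Cases d b v u
      by-coordinate (yes refl) cutᵤ cutᵥ = cut-cut-same⇒case-e edge cutᵤ cutᵥ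
      by-coordinate (no i≢j) cutᵤ cutᵥ = cut-cut⇒cases i≢j edge cutᵤ cutᵥ
      by-form : VertexForm u → VertexForm v → Cases d b u v ⊎ Cases d b v u
      by-form (inj₁ (S , u≈)) (inj₁ (T , v≈)) = inj₁ (set-set⇒case-a {S = S} {T} edge u≈ v≈)
      by-form (inj₁ (S , u≈)) (inj₂ (T , k , cut)) = inj₁ (set-cut⇒case-b {S = S} edge u≈ cut)
      by-form (inj₂ (S , k , cut)) (inj₁ (T , v≈)) = inj₂ (set-cut⇒case-b {S = T} (edge-sym edge) v≈ cut)
      by-form (inj₂ (S , i , cutᵤ)) (inj₂ (T , j , cutᵥ)) = by-coordinate (i ≟ᶠ j) cutᵤ cutᵥ

    backward : InP d b u → InP d b v → Cases d b u v → Adjacent d b u v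
    backward u∈P v∈P (case-a (S , T , u≈ , v≈ , ∣Δ∣≡1)) =
      cube-edge {S = S} {T} u∈P v∈P u≈ v≈ (symdiff≡⁅⁆⇒differOnlyAt {S = S} {T} (proj₂ (∣p∣≡1⇒p≡⁅k⁆ _ ∣Δ∣≡1)))
    backward u∈P v∈P (case-b (S , u≈ , inj₁ (i , i∉S , cut))) =
      truncated-cube-edge {R = S} u∈P v∈P (set-point-slack {S = S} u∈P u≈) (λ l _ _ → u≈ l)
        (inj₁ (trans (u≈ i) (∉⇒eS≡0 i∉S))) cut
    backward u∈P v∈P (case-b (S , u≈ , inj₂ (j , j∈S , cut))) =
      truncated-cube-edge {R = S ─ ⁅ j ⁆} u∈P v∈P (set-point-slack {S = S} u∈P u≈)
        (λ l l≢j _ → trans (u≈ l) (sym (eS-─⁅⁆-≢ S l≢j)))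
        (inj₂ (trans (u≈ j) (∈⇒eS≡1 j∈S))) cut
    backward u∈P v∈P (case-c (S , i , j , i≢j , _ , j∉S , cutᵤ , cutᵥ)) = case-c⇒adjacent u∈P v∈P i≢j j∉S cutᵤ cutᵥ
    backward u∈P v∈P (case-d (S , i , j , i≢j , _ , j∉S , cutᵤ , cutᵥ)) = case-d⇒adjacent u∈P v∈P i≢j j∉S cutᵤ cutᵥ
    backward u∈P v∈P (case-e (S , i , j , i≢j , _ , j∉S , cutᵤ , cutᵥ)) = case-e⇒adjacent u∈P v∈P i≢j j∉S cutᵤ cutᵥ
    backward u∈P v∈P (case-f (S , i , j , i≢j , _ , _ , cutᵤ , cutᵥ)) = case-f⇒adjacent u∈P v∈P i≢j cutᵤ cutᵥ

open import Data.Fin using (Fin)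
open import Data.Nat using (ℕ; _<_)
import Data.Nat as ℕ
open import Data.Nat.Divisibility using (_∣_)
open import Data.Product using (proj₁)
open import Data.Sum using (_⊎_; [_,_]′)
open import Function using (_∘′_)
open import Function.Bundles using (_⇔_; mk⇔)
open CutCubeEdges using (forward; backward; edge-sym)

lemma2p3 : (d : ℕ) (b : Fin d → ℕ) → (∀ i → 0 < b i) → 2 ∣ sumℕ b →
    (u v : Pt (d ℕ.+ 2)) → IsVertex d b u → IsVertex d b v →
    Adjacent d b u v ⇔ (Cases d b u v ⊎ Cases d b v u)
lemma2p3 d b _ _ u v u-vertex v-vertex = mk⇔ (forward d b u-vertex v-vertex)
  [ backward d b (proj₁ u-vertex) (proj₁ v-vertex)
  , edge-sym ∘′ backward d b (proj₁ v-vertex) (proj₁ u-vertex) ]′
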